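{- For every integer $m>14$, $n_p(\{3,m\};4)\le m+4\left\lceil\frac{m+1}{5}\right\rceil+3$.
   Context: All graphs are finite and simple. The girth of a graph is the length of a shortest cycle. For integers $2\le r<m$ and $g\ge 3$, an $(\{r,m\};g)$-graph is a graph of girth $g$ in which every vertex has degree $r$ or $m$, with at least one vertex of each of these degrees. $n_p(\{r,m\};g)$ denotes the minimum order of a planar $(\{r,m\};g)$-graph. -}

module Defs where

open import Data.Nat using (ℕ; zero; suc; _+_; _*_; _∸_; _≤_; _<_)
open import Data.Nat.DivMod using (_/_)
open import Data.Bool using (Bool; true; false)
open import Data.Fin using (Fin; inject₁; fromℕ) renaming (zero to fzero; suc to fsuc)
open import Data.List using (length; filterᵇ; allFin)
open import Data.Product using (Σ; ∃; _×_; _,_)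
open import Data.Sum using (_⊎_)
open import Data.Empty using (⊥)
open import Relation.Nullary using (¬_)
open import Relation.Binary.PropositionalEquality using (_≡_)
open import Function.Definitions using (Injective)
import Data.Rational as Q
open Q using (ℚ)

record Graph (n : ℕ) : Set where
  field
    adj    : Fin n → Fin n → Bool
    sym    : ∀ u v → adj u v ≡ adj v u
    irrefl : ∀ v → adj v v ≡ false

open Graph public

Adj : ∀ {n} → Graph n → Fin n → Fin n → Set
Adj G u v = adj G u v ≡ true

degree : ∀ {n} → Graph n → Fin n → ℕ
degree {n} G v = length (filterᵇ (adj G v) (allFin n))

-- G contains a cycle of length k: k distinct vertices c0,...,c(k-1) with
-- c_i ~ c_(i+1) and c_(k-1) ~ c_0.  (Only used with k ≥ 3.)
HasCycle : ∀ {n} → Graph n → ℕ → Set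
HasCycle G zero = ⊥
HasCycle {n} G (suc k) =
  Σ (Fin (suc k) → Fin n) λ c →
    Injective _≡_ _≡_ c
    × (∀ (i : Fin k) → Adj G (c (inject₁ i)) (c (fsuc i)))
    × Adj G (c (fromℕ k)) (c fzero)

Girth : ∀ {n} → Graph n → ℕ → Set
Girth G g = 3 ≤ g × HasCycle G g × (∀ k → 3 ≤ k → k < g → ¬ HasCycle G k)

IsRMGraph : ∀ {n} → ℕ → ℕ → ℕ → Graph n → Set
IsRMGraph {n} r m g G =
  (∀ v → degree G v ≡ r ⊎ degree G v ≡ m)
  × (∃ λ (v : Fin n) → degree G v ≡ r)
  × (∃ λ (v : Fin n) → degree G v ≡ m)
  × Girth G g

-- Planarity, via straight-line drawings with rational coordinates
-- (equivalent to the topological notion by Fáry's theorem and density of ℚ).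
Point : Set
Point = ℚ × ℚ

OnSegment : Point → Point → Point → Set
OnSegment (px , py) (ax , ay) (bx , by) =
  Σ ℚ λ s → Q.0ℚ Q.≤ s × s Q.≤ Q.1ℚ
    × px ≡ ax Q.+ s Q.* (bx Q.- ax)
    × py ≡ ay Q.+ s Q.* (by Q.- ay)

record StraightLineEmbedding {n} (G : Graph n) : Set where
  field
    pos       : Fin n → Point
    pos-inj   : Injective _≡_ _≡_ pos
    vertexOff : ∀ a b w → Adj G a b → OnSegment (pos w) (pos a) (pos b) → w ≡ a ⊎ w ≡ b
    noCross   : ∀ a b c d → Adj G a b → Adj G c d → ¬ ((a ≡ c × b ≡ d) ⊎ (a ≡ d × b ≡ c)) →
                ∀ p → OnSegment p (pos a) (pos b) → OnSegment p (pos c) (pos d) →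
                (p ≡ pos a ⊎ p ≡ pos b) × (p ≡ pos c ⊎ p ≡ pos d)

Planar : ∀ {n} → Graph n → Set
Planar G = StraightLineEmbedding G

ceilDiv : ℕ → (b : ℕ) → .{{_ : Data.Nat.NonZero b}} → ℕ
ceilDiv a b = (a + (b ∸ 1)) / b

module Submission where

-- The graph is a strip of slots p = 1, 2, …, each holding up to three vertices: (0, p) on the
-- spine and (±p, 0) on the east and west sides, plus a hub at (0, −1) joined to most side vertices.
-- Every other edge joins two vertices of one slot or of adjacent slots, so all edges are unit
-- segments on an axis or diagonals between two half-axes, and the diagonals in each quadrant are
-- nested; hence this straight-line drawing has no crossings.
-- The middle of the strip has period two, adding 3 to the hub degree and 5 vertices per period,
-- and the two end gadgets come in two variants each, differing by one hub edge. This gives hub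
-- degree m = 13 + 3k + e + t with n = m + 15 + 2k vertices, and 15 + 2k ≤ 4⌈(m+1)/5⌉ + 3.
-- Everything else is local: each window of three consecutive slots is checked by evaluation to
-- give degree 3 to the vertices of its middle slot and to map its edges to edges of the 5-cycle.
-- That map is a homomorphism to C₅, so there are no triangles, and a 4-cycle is visible.

open import Data.Bool using (Bool; false)
open import Data.List using (List)
open import Data.Nat using (ℕ)
open import Relation.Binary.PropositionalEquality using (_≡_)

module Lists where
  open import Data.Bool using (Bool; true; false; _∧_; T?)
  open import Data.Empty using (⊥-elim)
  open import Data.Fin using (zero; suc)
  open import Data.List using (List; []; _∷_; _++_; map; filterᵇ; length; lookup)
  open import Data.List.Membership.Propositional using (_∈_)
  open import Data.List.Membership.Propositional.Properties using (∈-lookup)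
  open import Data.List.Properties using (length-++; filter-++)
  open import Data.List.Relation.Unary.All as All using ()
  open import Data.List.Relation.Unary.AllPairs using ([]; _∷_)
  open import Data.List.Relation.Unary.Any using (here; there)
  open import Data.List.Relation.Unary.Unique.Propositional using (Unique)
  open import Data.Nat using (ℕ; zero; suc; _+_; _≤_; _<_; z≤n; s≤s)
  open import Data.Nat.Properties
    using (+-suc; +-identityʳ; +-comm; +-assoc; ≤-refl; <⇒≤; m<m+n; ≤-<-trans; <-irrefl; m≤n⇒m<n∨m≡n)
  open import Data.Product using (_×_; _,_; proj₁)
  open import Data.Sum using (_⊎_; inj₁; inj₂)
  open import Function using (_∘_)
  open import Relation.Binary.PropositionalEquality

  ⟦_⟧ : Bool → ℕ
  ⟦ true ⟧ = 1
  ⟦ false ⟧ = 0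

  count : {A : Set} → (A → Bool) → List A → ℕ
  count P xs = length (filterᵇ P xs)

  module _ {A : Set} where

    count-∷ : ∀ (P : A → Bool) x xs → count P (x ∷ xs) ≡ ⟦ P x ⟧ + count P xs
    count-∷ P x xs with P x
    ... | true = refl
    ... | false = refl

    count-++ : ∀ (P : A → Bool) xs ys → count P (xs ++ ys) ≡ count P xs + count P ys
    count-++ P xs ys = trans (cong length (filter-++ (T? ∘ P) xs ys)) (length-++ (filterᵇ P xs))

    count-filter : ∀ (P Q : A → Bool) xs → count P (filterᵇ Q xs) ≡ count (λ x → Q x ∧ P x) xs
    count-filter P Q [] = refl
    count-filter P Q (x ∷ xs) rewrite count-∷ (λ x → Q x ∧ P x) x xs with Q x
    ... | true = trans (count-∷ P x (filterᵇ Q xs)) (cong (⟦ P x ⟧ +_) (count-filter P Q xs))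
    ... | false = count-filter P Q xs

  count-map : ∀ {A B : Set} (P : B → Bool) (f : A → B) xs → count P (map f xs) ≡ count (P ∘ f) xs
  count-map P f [] = refl
  count-map P f (x ∷ xs) =
    trans (count-∷ P (f x) (map f xs)) (trans (cong (⟦ P (f x) ⟧ +_) (count-map P f xs)) (sym (count-∷ (P ∘ f) x xs)))

  interval : ℕ → ℕ → List ℕ
  interval s zero = []
  interval s (suc n) = s ∷ interval (suc s) n

  interval-++ : ∀ s m n → interval s (m + n) ≡ interval s m ++ interval (s + m) n
  interval-++ s zero n = cong (λ s′ → interval s′ n) (sym (+-identityʳ s))
  interval-++ s (suc m) n =
    cong (s ∷_) (trans (interval-++ (suc s) m n) (cong (λ s′ → interval (suc s) m ++ interval s′ n) (sym (+-suc s m))))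

  map-interval-suc : ∀ {A : Set} (f : ℕ → A) s n → map f (interval (suc s) n) ≡ map (f ∘ suc) (interval s n)
  map-interval-suc f s zero = refl
  map-interval-suc f s (suc n) = cong (f (suc s) ∷_) (map-interval-suc f (suc s) n)

  interval-∈ : ∀ {x} s n → x ∈ interval s n → s ≤ x × x < s + n
  interval-∈ s (suc n) (here refl) = ≤-refl , m<m+n s (s≤s z≤n)
  interval-∈ {x} s (suc n) (there x∈) with interval-∈ (suc s) n x∈
  ... | s<x , x<1+s+n = <⇒≤ s<x , subst (x <_) (sym (+-suc s n)) x<1+s+n

  ∈-interval : ∀ {x} s n → s ≤ x → x < s + n → x ∈ interval s n
  ∈-interval {x} s zero s≤x x<s+0 = ⊥-elim (<-irrefl refl (≤-<-trans s≤x (subst (x <_) (+-identityʳ s) x<s+0)))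
  ∈-interval {x} s (suc n) s≤x x<s+1+n with m≤n⇒m<n∨m≡n s≤x
  ... | inj₂ refl = here refl
  ... | inj₁ s<x = there (∈-interval (suc s) n s<x (subst (x <_) (+-suc s n) x<s+1+n))

  interval-unique : ∀ s n → Unique (interval s n)
  interval-unique s zero = []
  interval-unique s (suc n) =
    All.tabulate (λ x∈ s≡x → <-irrefl s≡x (proj₁ (interval-∈ (suc s) n x∈))) ∷ interval-unique (suc s) n

  count-none : ∀ (P : ℕ → Bool) s n → (∀ x → s ≤ x → x < s + n → P x ≡ false) → count P (interval s n) ≡ 0
  count-none P s zero _ = refl
  count-none P s (suc n) vanish =
    trans (count-∷ P s (interval (suc s) n))
          (cong₂ _+_ (cong ⟦_⟧ (vanish s ≤-refl (m<m+n s (s≤s z≤n))))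
                     (count-none P (suc s) n λ x s<x x<s+n → vanish x (<⇒≤ s<x) (subst (x <_) (sym (+-suc s n)) x<s+n)))

  count-window : ∀ (P : ℕ → Bool) N q → (∀ x → N ≤ x → P x ≡ false) → (∀ x → x < q ⊎ 3 + q ≤ x → P x ≡ false) →
                 count P (interval 0 N) ≡ ⟦ P q ⟧ + (⟦ P (suc q) ⟧ + ⟦ P (2 + q) ⟧)
  count-window P N q beyond outside = begin
    count P (interval 0 N)
      ≡⟨ sym (trans (cong (count P (interval 0 N) +_) (count-none P N (3 + q) λ x N≤x _ → beyond x N≤x)) (+-identityʳ _)) ⟩
    count P (interval 0 N) + count P (interval N (3 + q))
      ≡⟨ sym (trans (cong (count P) (interval-++ 0 N (3 + q))) (count-++ P (interval 0 N) (interval N (3 + q)))) ⟩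
    count P (interval 0 (N + (3 + q)))
      ≡⟨ cong (count P ∘ interval 0) reshuffle ⟩
    count P (interval 0 (q + (3 + N)))
      ≡⟨ trans (cong (count P) (interval-++ 0 q (3 + N))) (count-++ P (interval 0 q) (interval q (3 + N))) ⟩
    count P (interval 0 q) + count P (interval q (3 + N))
      ≡⟨ cong₂ _+_ (count-none P 0 q λ x _ x<q → outside x (inj₁ x<q)) window ⟩
    ⟦ P q ⟧ + (⟦ P (suc q) ⟧ + ⟦ P (2 + q) ⟧) ∎
    where
    open ≡-Reasoning
    reshuffle : N + (3 + q) ≡ q + (3 + N)
    reshuffle = trans (+-comm N (3 + q)) (trans (cong (_+ N) (+-comm 3 q)) (+-assoc q 3 N))
    rest : count P (interval (3 + q) N) ≡ 0
    rest = count-none P (3 + q) N λ x 3+q≤x _ → outside x (inj₂ 3+q≤x)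
    window : count P (interval q (3 + N)) ≡ ⟦ P q ⟧ + (⟦ P (suc q) ⟧ + ⟦ P (2 + q) ⟧)
    window = begin
      count P (interval q (3 + N))
        ≡⟨ count-∷ P q _ ⟩
      ⟦ P q ⟧ + count P (interval (suc q) (2 + N))
        ≡⟨ cong (⟦ P q ⟧ +_) (count-∷ P (suc q) _) ⟩
      ⟦ P q ⟧ + (⟦ P (suc q) ⟧ + count P (interval (2 + q) (1 + N)))
        ≡⟨ cong (λ z → ⟦ P q ⟧ + (⟦ P (suc q) ⟧ + z)) (trans (count-∷ P (2 + q) _) (cong (⟦ P (2 + q) ⟧ +_) rest)) ⟩
      ⟦ P q ⟧ + (⟦ P (suc q) ⟧ + (⟦ P (2 + q) ⟧ + 0))
        ≡⟨ cong (λ z → ⟦ P q ⟧ + (⟦ P (suc q) ⟧ + z)) (+-identityʳ _) ⟩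
      ⟦ P q ⟧ + (⟦ P (suc q) ⟧ + ⟦ P (2 + q) ⟧) ∎

  lookup-injective : ∀ {A : Set} (xs : List A) → Unique xs → ∀ {i j} → lookup xs i ≡ lookup xs j → i ≡ j
  lookup-injective (x ∷ xs) (x∉ ∷ u) {zero} {zero} _ = refl
  lookup-injective (x ∷ xs) (x∉ ∷ u) {zero} {suc j} eq = ⊥-elim (All.lookup x∉ (∈-lookup j) eq)
  lookup-injective (x ∷ xs) (x∉ ∷ u) {suc i} {zero} eq = ⊥-elim (All.lookup x∉ (∈-lookup i) (sym eq))
  lookup-injective (x ∷ xs) (x∉ ∷ u) {suc i} {suc j} eq = cong suc (lookup-injective xs u eq)

module Geometry where
  open import Data.Bool using (Bool; true; false)
  open import Data.Empty using (⊥-elim)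
  open import Data.Fin using (Fin)
  open import Data.Integer using (+_; +≤+; +<+)
  import Data.Integer.Properties as ℤ
  open import Data.Nat as ℕ using (ℕ; suc; z≤n; s≤s)
  import Data.Nat.Properties as ℕ
  open import Data.Product using (Σ; _×_; _,_; proj₁; proj₂)
  open import Data.Rational
    using (ℚ; 0ℚ; 1ℚ; _+_; _*_; _-_; -_; _≤_; _<_; *≤*; *<*; 1/_; ≢-nonZero; positive; nonNegative; ↥_)
  open import Data.Rational.Literals using (fromℤ)
  import Data.Rational.Properties as ℚ
  open import Data.Rational.Solver using (module +-*-Solver)
  open import Data.Sum using (_⊎_; inj₁; inj₂)
  open import Function.Definitions using (Injective)
  open import Relation.Binary.Definitions using (tri<; tri≈; tri>)
  open import Relation.Binary.PropositionalEquality
  open import Relation.Nullary using (¬_; Dec; yes; no)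

  open import Defs using (Graph; Adj; Point; OnSegment; Planar)

  open +-*-Solver

  ι : ℕ → ℚ
  ι n = fromℤ (+ n)

  ι-mono-≤ : ∀ {a b} → a ℕ.≤ b → ι a ≤ ι b
  ι-mono-≤ {a} {b} a≤b =
    *≤* (subst₂ Data.Integer._≤_ (sym (ℤ.*-identityʳ (+ a))) (sym (ℤ.*-identityʳ (+ b))) (+≤+ a≤b))

  ι-cancel-≤ : ∀ {a b} → ι a ≤ ι b → a ℕ.≤ b
  ι-cancel-≤ {a} {b} (*≤* le) with subst₂ Data.Integer._≤_ (ℤ.*-identityʳ (+ a)) (ℤ.*-identityʳ (+ b)) le
  ... | +≤+ a≤b = a≤b

  ι-injective : ∀ {a b} → ι a ≡ ι b → a ≡ b
  ι-injective eq = ℤ.+-injective (cong ↥_ eq)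

  ι-pos : ∀ {a} → 1 ℕ.≤ a → 0ℚ < ι a
  ι-pos {a} 1≤a = *<* (subst (Data.Integer._<_ _) (sym (ℤ.*-identityʳ (+ a))) (+<+ 1≤a))

  ι-nonNeg : ∀ a → 0ℚ ≤ ι a
  ι-nonNeg a = ι-mono-≤ {0} {a} z≤n

  zero-product : ∀ x y → x * y ≡ 0ℚ → x ≡ 0ℚ ⊎ y ≡ 0ℚ
  zero-product x y xy≡0 with x ℚ.≟ 0ℚ
  ... | yes x≡0 = inj₁ x≡0
  ... | no x≢0 = inj₂ (y≡0 {{≢-nonZero x≢0}})
    where
    open ≡-Reasoning
    y≡0 : {{_ : Data.Rational.NonZero x}} → y ≡ 0ℚ
    y≡0 = begin
      y                  ≡⟨ sym (ℚ.*-identityˡ y) ⟩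
      1ℚ * y             ≡⟨ cong (_* y) (sym (ℚ.*-inverseˡ x)) ⟩
      (1/ x * x) * y     ≡⟨ ℚ.*-assoc (1/ x) x y ⟩
      1/ x * (x * y)     ≡⟨ cong (1/ x *_) xy≡0 ⟩
      1/ x * 0ℚ          ≡⟨ ℚ.*-zeroʳ (1/ x) ⟩
      0ℚ                 ∎

  difference-zero : ∀ x y → x - y ≡ 0ℚ → x ≡ y
  difference-zero x y eq =
    trans (solve 2 (λ x y → x := (x :- y) :+ y) refl x y) (trans (cong (_+ y) eq) (ℚ.+-identityˡ y))

  ≤⇒0≤- : ∀ {x y} → x ≤ y → 0ℚ ≤ y - x
  ≤⇒0≤- {x} {y} x≤y = subst (_≤ y - x) (ℚ.+-inverseʳ x) (ℚ.+-monoˡ-≤ (- x) x≤y)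

  0≤-⇒≤ : ∀ {x y} → 0ℚ ≤ y - x → x ≤ y
  0≤-⇒≤ {x} {y} h =
    subst₂ _≤_ (ℚ.+-identityˡ x) (solve 2 (λ x y → (y :- x) :+ x := y) refl x y) (ℚ.+-monoˡ-≤ x h)

  *-nonNeg : ∀ {a b} → 0ℚ ≤ a → 0ℚ ≤ b → 0ℚ ≤ a * b
  *-nonNeg {a} {b} 0≤a 0≤b =
    subst (_≤ a * b) (ℚ.*-zeroʳ a) (ℚ.*-monoˡ-≤-nonNeg a {{nonNegative 0≤a}} 0≤b)

  *-cancelʳ-≤-pos : ∀ {x y} c → 0ℚ < c → x * c ≤ y * c → x ≤ y
  *-cancelʳ-≤-pos c 0<c = ℚ.*-cancelʳ-≤-pos c {{positive 0<c}}

  *-monoˡ-≤-nonNeg : ∀ {x y} c → 0ℚ ≤ c → x ≤ y → c * x ≤ c * y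
  *-monoˡ-≤-nonNeg c 0≤c = ℚ.*-monoˡ-≤-nonNeg c {{nonNegative 0≤c}}

  lerp-between : ∀ {a b u} → a ≤ b → 0ℚ ≤ u → u ≤ 1ℚ → a ≤ a + u * (b - a) × a + u * (b - a) ≤ b
  lerp-between {a} {b} {u} a≤b 0≤u u≤1 =
    0≤-⇒≤ (subst (0ℚ ≤_) (solve 3 (λ a b u → u :* (b :- a) := (a :+ u :* (b :- a)) :- a) refl a b u)
                          (*-nonNeg 0≤u (≤⇒0≤- a≤b))) ,
    0≤-⇒≤ (subst (0ℚ ≤_) (solve 3 (λ a b u → (con 1ℚ :- u) :* (b :- a) := b :- (a :+ u :* (b :- a))) refl a b u)
                          (*-nonNeg (≤⇒0≤- u≤1) (≤⇒0≤- a≤b)))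

  OnSegment-swap : ∀ p q r → OnSegment p q r → OnSegment p r q
  OnSegment-swap (px , py) (qx , qy) (rx , ry) (s , 0≤s , s≤1 , ex , ey) =
    1ℚ - s , ≤⇒0≤- s≤1 ,
    0≤-⇒≤ (subst (0ℚ ≤_) (solve 1 (λ s → s := con 1ℚ :- (con 1ℚ :- s)) refl s) 0≤s) ,
    trans ex (swap qx rx s) , trans ey (swap qy ry s)
    where
    swap : ∀ a b s → a + s * (b - a) ≡ b + (1ℚ - s) * (a - b)
    swap = solve 3 (λ a b s → a :+ s :* (b :- a) := b :+ (con 1ℚ :- s) :* (a :- b)) refl

  neg-involutive : ∀ q → - (- q) ≡ q
  neg-involutive = solve 1 (λ q → :- (:- q) := q) refl

  signed : Bool → ℚ → ℚ
  signed true q = q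
  signed false q = - q

  signed-involutive : ∀ σ q → signed σ (signed σ q) ≡ q
  signed-involutive true q = refl
  signed-involutive false q = neg-involutive q

  signed-zero : ∀ σ {q} → signed σ q ≡ 0ℚ → q ≡ 0ℚ
  signed-zero true eq = eq
  signed-zero false {q} eq = trans (sym (neg-involutive q)) (cong -_ eq)

  signed-lerp : ∀ σ a b u → signed σ (a + u * (b - a)) ≡ signed σ a + u * (signed σ b - signed σ a)
  signed-lerp true a b u = refl
  signed-lerp false = solve 3 (λ a b u → :- (a :+ u :* (b :- a)) := :- a :+ u :* (:- b :- :- a)) refl

  signed-opposite : ∀ {σ σ′} q → σ ≢ σ′ → 0ℚ ≤ signed σ q → 0ℚ ≤ signed σ′ q → q ≡ 0ℚ
  signed-opposite {true} {true} q σ≢σ′ _ _ = ⊥-elim (σ≢σ′ refl)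
  signed-opposite {false} {false} q σ≢σ′ _ _ = ⊥-elim (σ≢σ′ refl)
  signed-opposite {true} {false} q _ 0≤q 0≤-q =
    ℚ.≤-antisym (subst (_≤ 0ℚ) (neg-involutive q) (ℚ.neg-antimono-≤ 0≤-q)) 0≤q
  signed-opposite {false} {true} q _ 0≤-q 0≤q =
    ℚ.≤-antisym (subst (_≤ 0ℚ) (neg-involutive q) (ℚ.neg-antimono-≤ 0≤-q)) 0≤q

  signed-sign : ∀ σ σ′ {a c} → 1 ℕ.≤ c → ι c ≤ signed σ′ (signed σ (ι a)) → σ ≡ σ′
  signed-sign true true _ _ = refl
  signed-sign false false _ _ = refl
  signed-sign true false {a} 1≤c c≤ =
    ⊥-elim (ℚ.<-irrefl refl (ℚ.<-≤-trans (ι-pos 1≤c) (ℚ.≤-trans c≤ (ℚ.neg-antimono-≤ (ι-nonNeg a)))))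
  signed-sign false true {a} 1≤c c≤ =
    ⊥-elim (ℚ.<-irrefl refl (ℚ.<-≤-trans (ι-pos 1≤c) (ℚ.≤-trans c≤ (ℚ.neg-antimono-≤ (ι-nonNeg a)))))

  signed-0 : ∀ σ → signed σ 0ℚ ≡ 0ℚ
  signed-0 true = refl
  signed-0 false = refl

  unsigned : ∀ σ {x q} → signed σ x ≡ q → x ≡ signed σ q
  unsigned σ {x} eq = trans (sym (signed-involutive σ x)) (cong (signed σ) eq)

  toward-origin : ∀ σ A s → signed σ (signed σ A + s * (0ℚ - signed σ A)) ≡ (1ℚ - s) * A
  toward-origin true = solve 2 (λ A s → A :+ s :* (con 0ℚ :- A) := (con 1ℚ :- s) :* A) refl
  toward-origin false =
    solve 2 (λ A s → :- (:- A :+ s :* (con 0ℚ :- :- A)) := (con 1ℚ :- s) :* A) refl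

  away-from-origin : ∀ τ B s → signed τ (0ℚ + s * (signed τ B - 0ℚ)) ≡ s * B
  away-from-origin true = solve 2 (λ B s → con 0ℚ :+ s :* (B :- con 0ℚ) := s :* B) refl
  away-from-origin false =
    solve 2 (λ B s → :- (con 0ℚ :+ s :* (:- B :- con 0ℚ)) := s :* B) refl

  along-axis : ∀ σ A A′ s → signed σ (signed σ A + s * (signed σ A′ - signed σ A)) ≡ A + s * (A′ - A)
  along-axis σ A A′ s =
    trans (signed-lerp σ _ _ s)
          (cong₂ (λ a a′ → a + s * (a′ - a)) (signed-involutive σ A) (signed-involutive σ A′))

  across-axis : ∀ s → 0ℚ + s * (0ℚ - 0ℚ) ≡ 0ℚ
  across-axis = solve 1 (λ s → con 0ℚ :+ s :* (con 0ℚ :- con 0ℚ) := con 0ℚ) refl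

  data AxisPoint : Set where
    onX : Bool → ℕ → AxisPoint
    onY : Bool → ℕ → AxisPoint

  point : AxisPoint → Point
  point (onX σ a) = signed σ (ι a) , 0ℚ
  point (onY τ b) = 0ℚ , signed τ (ι b)

  AwayFromOrigin : AxisPoint → Set
  AwayFromOrigin (onX _ a) = 1 ℕ.≤ a
  AwayFromOrigin (onY _ b) = 1 ℕ.≤ b

  signed-ι-injective : ∀ σ σ′ {a a′} → 1 ℕ.≤ a′ → signed σ (ι a) ≡ signed σ′ (ι a′) → σ ≡ σ′ × a ≡ a′
  signed-ι-injective σ σ′ {a} {a′} 1≤a′ eq
    with signed-sign σ σ′ 1≤a′ (ℚ.≤-reflexive (sym (trans (cong (signed σ′) eq) (signed-involutive σ′ (ι a′)))))
  ... | refl = refl , ι-injective (trans (unsigned σ refl) (trans (cong (signed σ) eq) (signed-involutive σ (ι a′))))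

  signed-ι-nonzero : ∀ σ {a} → 1 ℕ.≤ a → signed σ (ι a) ≢ 0ℚ
  signed-ι-nonzero σ 1≤a eq = ℕ.>⇒≢ 1≤a (ι-injective (signed-zero σ eq))

  point-injective : ∀ W W′ → AwayFromOrigin W → AwayFromOrigin W′ → point W ≡ point W′ → W ≡ W′
  point-injective (onX σ a) (onX σ′ a′) _ 1≤a′ eq with signed-ι-injective σ σ′ 1≤a′ (cong proj₁ eq)
  ... | refl , refl = refl
  point-injective (onY τ b) (onY τ′ b′) _ 1≤b′ eq with signed-ι-injective τ τ′ 1≤b′ (cong proj₂ eq)
  ... | refl , refl = refl
  point-injective (onX σ a) (onY τ b) 1≤a _ eq = ⊥-elim (signed-ι-nonzero σ 1≤a (cong proj₁ eq))
  point-injective (onY τ b) (onX σ a) 1≤b _ eq = ⊥-elim (signed-ι-nonzero τ 1≤b (cong proj₂ eq))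

  -- The diagonals allowed in a quadrant, chosen so that any two of them are nested.
  data Rung : Bool → ℕ → ℕ → Set where
    level   : ∀ b → Rung true b b
    slanted : ∀ b → Rung true (suc b) b
    hubward : ∀ a → Rung false a 1

  rung-comparable : ∀ {τ a₁ b₁ a₂ b₂} → Rung τ a₁ b₁ → Rung τ a₂ b₂ →
                    (a₁ ℕ.≤ a₂ × b₁ ℕ.≤ b₂) ⊎ (a₂ ℕ.≤ a₁ × b₂ ℕ.≤ b₁)
  rung-comparable (level b₁) (level b₂) with ℕ.≤-total b₁ b₂
  ... | inj₁ b₁≤b₂ = inj₁ (b₁≤b₂ , b₁≤b₂)
  ... | inj₂ b₂≤b₁ = inj₂ (b₂≤b₁ , b₂≤b₁)
  rung-comparable (level b₁) (slanted b₂) with ℕ.≤-<-connex b₁ b₂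
  ... | inj₁ b₁≤b₂ = inj₁ (ℕ.m≤n⇒m≤1+n b₁≤b₂ , b₁≤b₂)
  ... | inj₂ b₂<b₁ = inj₂ (b₂<b₁ , ℕ.<⇒≤ b₂<b₁)
  rung-comparable (slanted b₁) (level b₂) = Data.Sum.swap (rung-comparable (level b₂) (slanted b₁))
  rung-comparable (slanted b₁) (slanted b₂) with ℕ.≤-total b₁ b₂
  ... | inj₁ b₁≤b₂ = inj₁ (s≤s b₁≤b₂ , b₁≤b₂)
  ... | inj₂ b₂≤b₁ = inj₂ (s≤s b₂≤b₁ , b₂≤b₁)
  rung-comparable (hubward a₁) (hubward a₂) with ℕ.≤-total a₁ a₂
  ... | inj₁ a₁≤a₂ = inj₁ (a₁≤a₂ , ℕ.≤-refl)
  ... | inj₂ a₂≤a₁ = inj₂ (a₂≤a₁ , ℕ.≤-refl)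

  data Stroke : AxisPoint → AxisPoint → Set where
    diagonal : ∀ σ {τ a b} → 1 ℕ.≤ a → 1 ℕ.≤ b → Rung τ a b → Stroke (onX σ a) (onY τ b)
    alongX   : ∀ σ {a} → 1 ℕ.≤ a → Stroke (onX σ a) (onX σ (suc a))
    alongY   : ∀ {b} → 1 ℕ.≤ b → Stroke (onY true b) (onY true (suc b))

  record OnStroke (p : Point) (A B : AxisPoint) : Set where
    constructor onStroke
    field onSegment : OnSegment p (point A) (point B)

  OnStroke-swap : ∀ {p A B} → OnStroke p A B → OnStroke p B A
  OnStroke-swap {p} {A} {B} (onStroke o) = onStroke (OnSegment-swap p (point A) (point B) o)

  DiagonalPoint : Bool → Bool → ℕ → ℕ → Point → ℚ → Set
  DiagonalPoint σ τ a b (px , py) s =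
    0ℚ ≤ s × s ≤ 1ℚ × signed σ px ≡ (1ℚ - s) * ι a × signed τ py ≡ s * ι b

  diagonal-point : ∀ {σ τ a b} p → OnStroke p (onX σ a) (onY τ b) → Σ ℚ (DiagonalPoint σ τ a b p)
  diagonal-point {σ} {τ} {a} {b} (px , py) (onStroke (s , 0≤s , s≤1 , ex , ey)) =
    s , 0≤s , s≤1 , trans (cong (signed σ) ex) (toward-origin σ (ι a) s)
                  , trans (cong (signed τ) ey) (away-from-origin τ (ι b) s)

  alongX-point : ∀ {σ a} px py → OnStroke (px , py) (onX σ a) (onX σ (suc a)) →
                 (ι a ≤ signed σ px × signed σ px ≤ ι (suc a)) × py ≡ 0ℚ
  alongX-point {σ} {a} px py (onStroke (u , 0≤u , u≤1 , ex , ey)) =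
    subst (λ q → ι a ≤ q × q ≤ ι (suc a)) (sym (trans (cong (signed σ) ex) (along-axis σ _ _ u)))
          (lerp-between (ι-mono-≤ (ℕ.n≤1+n a)) 0≤u u≤1) ,
    trans ey (across-axis u)

  alongY-point : ∀ {b} px py → OnStroke (px , py) (onY true b) (onY true (suc b)) →
                 px ≡ 0ℚ × (ι b ≤ py × py ≤ ι (suc b))
  alongY-point {b} px py (onStroke (u , 0≤u , u≤1 , ex , ey)) =
    trans ex (across-axis u) ,
    subst (λ q → ι b ≤ q × q ≤ ι (suc b)) (sym ey) (lerp-between (ι-mono-≤ (ℕ.n≤1+n b)) 0≤u u≤1)

  diagonal-start : ∀ {σ τ a b} p → DiagonalPoint σ τ a b p 0ℚ → p ≡ point (onX σ a)
  diagonal-start {σ} {τ} {a} {b} (px , py) (_ , _ , ex , ey) =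
    cong₂ _,_ (unsigned σ (trans ex (ℚ.*-identityˡ (ι a))))
              (signed-zero τ (trans ey (ℚ.*-zeroˡ (ι b))))

  diagonal-end : ∀ {σ τ a b} p → DiagonalPoint σ τ a b p 1ℚ → p ≡ point (onY τ b)
  diagonal-end {σ} {τ} {a} {b} (px , py) (_ , _ , ex , ey) =
    cong₂ _,_ (signed-zero σ (trans ex (ℚ.*-zeroˡ (ι a))))
              (unsigned τ (trans ey (ℚ.*-identityˡ (ι b))))

  diagonal-on-xAxis : ∀ {σ τ a b px py} → 1 ℕ.≤ b → OnStroke (px , py) (onX σ a) (onY τ b) →
                      py ≡ 0ℚ → (px , py) ≡ point (onX σ a)
  diagonal-on-xAxis {σ} {τ} {a} {b} {px} {py} 1≤b on py≡0 with diagonal-point {σ} {τ} {a} {b} (px , py) on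
  ... | s , d@(_ , _ , _ , ey) with zero-product s (ι b) (trans (sym ey) (trans (cong (signed τ) py≡0) (signed-0 τ)))
  ...   | inj₁ refl = diagonal-start {σ} {τ} {a} {b} (px , py) d
  ...   | inj₂ ιb≡0 = ⊥-elim (signed-ι-nonzero true 1≤b ιb≡0)

  diagonal-on-yAxis : ∀ {σ τ a b px py} → 1 ℕ.≤ a → OnStroke (px , py) (onX σ a) (onY τ b) →
                      px ≡ 0ℚ → (px , py) ≡ point (onY τ b)
  diagonal-on-yAxis {σ} {τ} {a} {b} {px} {py} 1≤a on px≡0 with diagonal-point {σ} {τ} {a} {b} (px , py) on
  ... | s , d@(_ , _ , ex , _) with zero-product (1ℚ - s) (ι a) (trans (sym ex) (trans (cong (signed σ) px≡0) (signed-0 σ)))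
  ...   | inj₁ 1-s≡0 =
    diagonal-end {σ} {τ} {a} {b} (px , py) (subst (DiagonalPoint σ τ a b (px , py)) (sym (difference-zero 1ℚ s 1-s≡0)) d)
  ...   | inj₂ ιa≡0 = ⊥-elim (signed-ι-nonzero true 1≤a ιa≡0)

  diagonal-x-nonNeg : ∀ {σ τ a b px py} → OnStroke (px , py) (onX σ a) (onY τ b) → 0ℚ ≤ signed σ px
  diagonal-x-nonNeg {σ} {τ} {a} {b} {px} {py} on with diagonal-point {σ} {τ} {a} {b} (px , py) on
  ... | s , _ , s≤1 , ex , _ = subst (0ℚ ≤_) (sym ex) (*-nonNeg (≤⇒0≤- s≤1) (ι-nonNeg a))

  diagonal-y-nonNeg : ∀ {σ τ a b px py} → OnStroke (px , py) (onX σ a) (onY τ b) → 0ℚ ≤ signed τ py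
  diagonal-y-nonNeg {σ} {τ} {a} {b} {px} {py} on with diagonal-point {σ} {τ} {a} {b} (px , py) on
  ... | s , 0≤s , _ , _ , ey = subst (0ℚ ≤_) (sym ey) (*-nonNeg 0≤s (ι-nonNeg b))

  *-cancelˡ-or-zero : ∀ x y z → x * y ≡ x * z → x ≡ 0ℚ ⊎ y ≡ z
  *-cancelˡ-or-zero x y z eq =
    Data.Sum.map₂ (λ z-y≡0 → sym (difference-zero z y z-y≡0)) (zero-product x (z - y) x[z-y]≡0)
    where
    x[z-y]≡0 : x * (z - y) ≡ 0ℚ
    x[z-y]≡0 = trans (solve 3 (λ x y z → x :* (z :- y) := x :* z :- x :* y) refl x y z)
                     (trans (cong (_- x * y) (sym eq)) (ℚ.+-inverseʳ (x * y)))

  nested-diagonals : ∀ {A₁ A₂ B₁ B₂ s t} → 0ℚ < A₁ → 0ℚ < B₁ → A₁ ≤ A₂ → B₁ ≤ B₂ →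
                     0ℚ ≤ t → t ≤ 1ℚ → (1ℚ - s) * A₁ ≡ (1ℚ - t) * A₂ → s * B₁ ≡ t * B₂ →
                     (s ≡ 0ℚ × t ≡ 0ℚ) ⊎ (s ≡ 1ℚ × t ≡ 1ℚ) ⊎ (A₁ ≡ A₂ × B₁ ≡ B₂)
  nested-diagonals {A₁} {A₂} {B₁} {B₂} {s} {t} 0<A₁ 0<B₁ A₁≤A₂ B₁≤B₂ 0≤t t≤1 ex ey =
    conclude (*-cancelˡ-or-zero s B₁ B₂ sB₁≡sB₂) (*-cancelˡ-or-zero (1ℚ - s) A₁ A₂ [1-s]A₁≡[1-s]A₂)
    where
    t≤s : t ≤ s
    t≤s = *-cancelʳ-≤-pos B₁ 0<B₁ (ℚ.≤-trans (*-monoˡ-≤-nonNeg t 0≤t B₁≤B₂) (ℚ.≤-reflexive (sym ey)))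
    s≤t : s ≤ t
    s≤t = 0≤-⇒≤ {s} {t} (subst (0ℚ ≤_) (solve 2 (λ s t → (con 1ℚ :- s) :- (con 1ℚ :- t) := t :- s) refl s t)
            (≤⇒0≤- (*-cancelʳ-≤-pos {1ℚ - t} {1ℚ - s} A₁ 0<A₁
              (ℚ.≤-trans (*-monoˡ-≤-nonNeg (1ℚ - t) (≤⇒0≤- t≤1) A₁≤A₂) (ℚ.≤-reflexive (sym ex))))))
    s≡t : s ≡ t
    s≡t = ℚ.≤-antisym s≤t t≤s
    sB₁≡sB₂ : s * B₁ ≡ s * B₂
    sB₁≡sB₂ = trans ey (cong (_* B₂) (sym s≡t))
    [1-s]A₁≡[1-s]A₂ : (1ℚ - s) * A₁ ≡ (1ℚ - s) * A₂
    [1-s]A₁≡[1-s]A₂ = trans ex (cong (λ r → (1ℚ - r) * A₂) (sym s≡t))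
    conclude : s ≡ 0ℚ ⊎ B₁ ≡ B₂ → 1ℚ - s ≡ 0ℚ ⊎ A₁ ≡ A₂ →
               (s ≡ 0ℚ × t ≡ 0ℚ) ⊎ (s ≡ 1ℚ × t ≡ 1ℚ) ⊎ (A₁ ≡ A₂ × B₁ ≡ B₂)
    conclude (inj₁ s≡0) _ = inj₁ (s≡0 , trans (sym s≡t) s≡0)
    conclude (inj₂ _) (inj₁ 1-s≡0) = inj₂ (inj₁ (s≡1 , trans (sym s≡t) s≡1))
      where s≡1 = sym (difference-zero 1ℚ s 1-s≡0)
    conclude (inj₂ B₁≡B₂) (inj₂ A₁≡A₂) = inj₂ (inj₂ (A₁≡A₂ , B₁≡B₂))

  unit-intervals : ∀ {q} a₁ a₂ → ι a₁ ≤ q → q ≤ ι (suc a₁) → ι a₂ ≤ q → q ≤ ι (suc a₂) →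
                   a₁ ≡ a₂ ⊎ (q ≡ ι (suc a₁) × q ≡ ι a₂) ⊎ (q ≡ ι a₁ × q ≡ ι (suc a₂))
  unit-intervals a₁ a₂ lo₁ hi₁ lo₂ hi₂ with ℕ.<-cmp a₁ a₂
  ... | tri≈ _ a₁≡a₂ _ = inj₁ a₁≡a₂
  ... | tri< a₁<a₂ _ _ = inj₂ (inj₁ (ℚ.≤-antisym hi₁ (ℚ.≤-trans (ι-mono-≤ a₁<a₂) lo₂) ,
                                     ℚ.≤-antisym (ℚ.≤-trans hi₁ (ι-mono-≤ a₁<a₂)) lo₂))
  ... | tri> _ _ a₂<a₁ = inj₂ (inj₂ (ℚ.≤-antisym (ℚ.≤-trans hi₂ (ι-mono-≤ a₂<a₁)) lo₁ ,
                                     ℚ.≤-antisym hi₂ (ℚ.≤-trans (ι-mono-≤ a₂<a₁) lo₁)))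

  unit-interval-integer : ∀ {a c} → ι a ≤ ι c → ι c ≤ ι (suc a) → c ≡ a ⊎ c ≡ suc a
  unit-interval-integer {a} {c} lo hi with ℕ.m≤n⇒m<n∨m≡n (ι-cancel-≤ hi)
  ... | inj₁ (s≤s c≤a) = inj₁ (ℕ.≤-antisym c≤a (ι-cancel-≤ lo))
  ... | inj₂ c≡1+a = inj₂ c≡1+a

  alongX-vertex : ∀ {σ σ′ a c} → 1 ℕ.≤ a → OnStroke (point (onX σ′ c)) (onX σ a) (onX σ (suc a)) →
                  onX σ′ c ≡ onX σ a ⊎ onX σ′ c ≡ onX σ (suc a)
  alongX-vertex {σ} {σ′} {a} {c} 1≤a on = vertex (signed-sign σ′ σ 1≤a lo) lo hi
    where
    lo = proj₁ (proj₁ (alongX-point {σ} {a} _ _ on))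
    hi = proj₂ (proj₁ (alongX-point {σ} {a} _ _ on))
    vertex : σ′ ≡ σ → ι a ≤ signed σ (signed σ′ (ι c)) → signed σ (signed σ′ (ι c)) ≤ ι (suc a) →
             onX σ′ c ≡ onX σ a ⊎ onX σ′ c ≡ onX σ (suc a)
    vertex refl lo hi with unit-interval-integer (subst (ι a ≤_) eq lo) (subst (_≤ ι (suc a)) eq hi)
      where eq = signed-involutive σ (ι c)
    ... | inj₁ refl = inj₁ refl
    ... | inj₂ refl = inj₂ refl

  alongY-vertex : ∀ {τ b c} → 1 ℕ.≤ b → OnStroke (point (onY τ c)) (onY true b) (onY true (suc b)) →
                  onY τ c ≡ onY true b ⊎ onY τ c ≡ onY true (suc b)
  alongY-vertex {τ} {b} {c} 1≤b on = vertex (signed-sign τ true 1≤b lo) lo hi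
    where
    lo = proj₁ (proj₂ (alongY-point {b} _ _ on))
    hi = proj₂ (proj₂ (alongY-point {b} _ _ on))
    vertex : τ ≡ true → ι b ≤ signed τ (ι c) → signed τ (ι c) ≤ ι (suc b) →
             onY τ c ≡ onY true b ⊎ onY τ c ≡ onY true (suc b)
    vertex refl lo hi with unit-interval-integer lo hi
    ... | inj₁ refl = inj₁ refl
    ... | inj₂ refl = inj₂ refl

  alongX-off-yAxis : ∀ {σ a px py} → 1 ℕ.≤ a → OnStroke (px , py) (onX σ a) (onX σ (suc a)) → px ≢ 0ℚ
  alongX-off-yAxis {σ} {a} {px} {py} 1≤a on px≡0 =
    ℚ.<-irrefl refl (ℚ.<-≤-trans (ι-pos 1≤a) (subst (ι a ≤_) (trans (cong (signed σ) px≡0) (signed-0 σ))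
                                                    (proj₁ (proj₁ (alongX-point {σ} {a} px py on)))))

  alongY-off-xAxis : ∀ {b px py} → 1 ℕ.≤ b → OnStroke (px , py) (onY true b) (onY true (suc b)) → py ≢ 0ℚ
  alongY-off-xAxis {b} {px} {py} 1≤b on py≡0 =
    ℚ.<-irrefl refl (ℚ.<-≤-trans (ι-pos 1≤b) (subst (ι b ≤_) py≡0 (proj₁ (proj₂ (alongY-point {b} px py on)))))

  on-xAxis : ∀ σ {px py c} → signed σ px ≡ ι c → py ≡ 0ℚ → (px , py) ≡ point (onX σ c)
  on-xAxis σ eq py≡0 = cong₂ _,_ (unsigned σ eq) py≡0

  on-yAxis : ∀ {px py c} → px ≡ 0ℚ → py ≡ ι c → (px , py) ≡ point (onY true c)
  on-yAxis px≡0 eq = cong₂ _,_ px≡0 eq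

  Ends : Point → AxisPoint → AxisPoint → Set
  Ends p A B = p ≡ point A ⊎ p ≡ point B

  Meets : Point → AxisPoint → AxisPoint → AxisPoint → AxisPoint → Set
  Meets p A₁ B₁ A₂ B₂ = (Ends p A₁ B₁ × Ends p A₂ B₂) ⊎ (A₁ ≡ A₂ × B₁ ≡ B₂) ⊎ (A₁ ≡ B₂ × B₁ ≡ A₂)

  meets-sym : ∀ {p A₁ B₁ A₂ B₂} → Meets p A₂ B₂ A₁ B₁ → Meets p A₁ B₁ A₂ B₂
  meets-sym (inj₁ (e₂ , e₁)) = inj₁ (e₁ , e₂)
  meets-sym (inj₂ (inj₁ (a , b))) = inj₂ (inj₁ (sym a , sym b))
  meets-sym (inj₂ (inj₂ (a , b))) = inj₂ (inj₂ (sym b , sym a))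

  meets-flipˡ : ∀ {p A₁ B₁ A₂ B₂} → Meets p B₁ A₁ A₂ B₂ → Meets p A₁ B₁ A₂ B₂
  meets-flipˡ (inj₁ (e₁ , e₂)) = inj₁ (Data.Sum.swap e₁ , e₂)
  meets-flipˡ (inj₂ (inj₁ (a , b))) = inj₂ (inj₂ (b , a))
  meets-flipˡ (inj₂ (inj₂ (a , b))) = inj₂ (inj₁ (b , a))

  diagonals-meet : ∀ {σ τ a₁ b₁ a₂ b₂ s t} p → DiagonalPoint σ τ a₁ b₁ p s → DiagonalPoint σ τ a₂ b₂ p t →
                   (s ≡ 0ℚ × t ≡ 0ℚ) ⊎ (s ≡ 1ℚ × t ≡ 1ℚ) ⊎ (ι a₁ ≡ ι a₂ × ι b₁ ≡ ι b₂) →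
                   Meets p (onX σ a₁) (onY τ b₁) (onX σ a₂) (onY τ b₂)
  diagonals-meet {σ} {τ} {a₁} {b₁} {a₂} {b₂} p d₁ d₂ (inj₁ (refl , refl)) =
    inj₁ (inj₁ (diagonal-start {σ} {τ} {a₁} {b₁} p d₁) , inj₁ (diagonal-start {σ} {τ} {a₂} {b₂} p d₂))
  diagonals-meet {σ} {τ} {a₁} {b₁} {a₂} {b₂} p d₁ d₂ (inj₂ (inj₁ (refl , refl))) =
    inj₁ (inj₂ (diagonal-end {σ} {τ} {a₁} {b₁} p d₁) , inj₂ (diagonal-end {σ} {τ} {a₂} {b₂} p d₂))
  diagonals-meet p d₁ d₂ (inj₂ (inj₂ (a₁≡a₂ , b₁≡b₂))) =
    inj₂ (inj₁ (cong (onX _) (ι-injective a₁≡a₂) , cong (onY _) (ι-injective b₁≡b₂)))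

  diagonal-diagonal : ∀ {σ₁ τ₁ a₁ b₁ σ₂ τ₂ a₂ b₂ px py} → Dec (σ₁ ≡ σ₂) → Dec (τ₁ ≡ τ₂) →
                      1 ℕ.≤ a₁ → 1 ℕ.≤ b₁ → Rung τ₁ a₁ b₁ → 1 ℕ.≤ a₂ → 1 ℕ.≤ b₂ → Rung τ₂ a₂ b₂ →
                      OnStroke (px , py) (onX σ₁ a₁) (onY τ₁ b₁) → OnStroke (px , py) (onX σ₂ a₂) (onY τ₂ b₂) →
                      Meets (px , py) (onX σ₁ a₁) (onY τ₁ b₁) (onX σ₂ a₂) (onY τ₂ b₂)
  diagonal-diagonal {px = px} (no σ₁≢σ₂) _ 1≤a₁ _ _ 1≤a₂ _ _ o₁ o₂ =
    inj₁ (inj₂ (diagonal-on-yAxis 1≤a₁ o₁ px≡0) , inj₂ (diagonal-on-yAxis 1≤a₂ o₂ px≡0))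
    where px≡0 = signed-opposite px σ₁≢σ₂ (diagonal-x-nonNeg o₁) (diagonal-x-nonNeg o₂)
  diagonal-diagonal {py = py} (yes refl) (no τ₁≢τ₂) _ 1≤b₁ _ _ 1≤b₂ _ o₁ o₂ =
    inj₁ (inj₁ (diagonal-on-xAxis 1≤b₁ o₁ py≡0) , inj₁ (diagonal-on-xAxis 1≤b₂ o₂ py≡0))
    where py≡0 = signed-opposite py τ₁≢τ₂ (diagonal-y-nonNeg o₁) (diagonal-y-nonNeg o₂)
  diagonal-diagonal {σ} {τ} {a₁} {b₁} {_} {_} {a₂} {b₂} {px} {py} (yes refl) (yes refl) 1≤a₁ 1≤b₁ r₁ 1≤a₂ 1≤b₂ r₂ o₁ o₂
    with diagonal-point {σ} {τ} {a₁} {b₁} (px , py) o₁ | diagonal-point {σ} {τ} {a₂} {b₂} (px , py) o₂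
       | rung-comparable r₁ r₂
  ... | s , d₁@(0≤s , s≤1 , ex₁ , ey₁) | t , d₂@(0≤t , t≤1 , ex₂ , ey₂) | inj₁ (a₁≤a₂ , b₁≤b₂) =
    diagonals-meet (px , py) d₁ d₂
      (nested-diagonals (ι-pos 1≤a₁) (ι-pos 1≤b₁) (ι-mono-≤ a₁≤a₂) (ι-mono-≤ b₁≤b₂) 0≤t t≤1
                        (trans (sym ex₁) ex₂) (trans (sym ey₁) ey₂))
  ... | s , d₁@(0≤s , s≤1 , ex₁ , ey₁) | t , d₂@(0≤t , t≤1 , ex₂ , ey₂) | inj₂ (a₂≤a₁ , b₂≤b₁) =
    meets-sym (diagonals-meet (px , py) d₂ d₁
      (nested-diagonals (ι-pos 1≤a₂) (ι-pos 1≤b₂) (ι-mono-≤ a₂≤a₁) (ι-mono-≤ b₂≤b₁) 0≤s s≤1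
                        (trans (sym ex₂) ex₁) (trans (sym ey₂) ey₁)))

  diagonal-alongX : ∀ {σ₁ τ₁ a₁ b₁ σ₂ a₂ px py} → 1 ℕ.≤ b₁ → 1 ℕ.≤ a₂ →
                    OnStroke (px , py) (onX σ₁ a₁) (onY τ₁ b₁) → OnStroke (px , py) (onX σ₂ a₂) (onX σ₂ (suc a₂)) →
                    Meets (px , py) (onX σ₁ a₁) (onY τ₁ b₁) (onX σ₂ a₂) (onX σ₂ (suc a₂))
  diagonal-alongX {σ₁} {τ₁} {a₁} {b₁} {σ₂} {a₂} {px} {py} 1≤b₁ 1≤a₂ o₁ o₂ =
    inj₁ (inj₁ p≡ , Data.Sum.map (λ e → trans p≡ (cong point e)) (λ e → trans p≡ (cong point e))
                                 (alongX-vertex {σ₂} {σ₁} {a₂} {a₁} 1≤a₂ (subst (λ q → OnStroke q _ _) p≡ o₂)))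
    where p≡ = diagonal-on-xAxis 1≤b₁ o₁ (proj₂ (alongX-point {σ₂} {a₂} px py o₂))

  diagonal-alongY : ∀ {σ₁ τ₁ a₁ b₁ b₂ px py} → 1 ℕ.≤ a₁ → 1 ℕ.≤ b₂ →
                    OnStroke (px , py) (onX σ₁ a₁) (onY τ₁ b₁) → OnStroke (px , py) (onY true b₂) (onY true (suc b₂)) →
                    Meets (px , py) (onX σ₁ a₁) (onY τ₁ b₁) (onY true b₂) (onY true (suc b₂))
  diagonal-alongY {σ₁} {τ₁} {a₁} {b₁} {b₂} {px} {py} 1≤a₁ 1≤b₂ o₁ o₂ =
    inj₁ (inj₂ p≡ , Data.Sum.map (λ e → trans p≡ (cong point e)) (λ e → trans p≡ (cong point e))
                                 (alongY-vertex {τ₁} {b₂} {b₁} 1≤b₂ (subst (λ q → OnStroke q _ _) p≡ o₂)))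
    where p≡ = diagonal-on-yAxis 1≤a₁ o₁ (proj₁ (alongY-point {b₂} px py o₂))

  axis-strokes-meet : ∀ {p q a₁ a₂} (A : ℕ → AxisPoint) → (∀ {c} → q ≡ ι c → p ≡ point (A c)) →
                      ι a₁ ≤ q → q ≤ ι (suc a₁) → ι a₂ ≤ q → q ≤ ι (suc a₂) →
                      Meets p (A a₁) (A (suc a₁)) (A a₂) (A (suc a₂))
  axis-strokes-meet {p} {q} {a₁} {a₂} A at lo₁ hi₁ lo₂ hi₂ = meet (unit-intervals a₁ a₂ lo₁ hi₁ lo₂ hi₂)
    where
    meet : a₁ ≡ a₂ ⊎ (q ≡ ι (suc a₁) × q ≡ ι a₂) ⊎ (q ≡ ι a₁ × q ≡ ι (suc a₂)) →
           Meets p (A a₁) (A (suc a₁)) (A a₂) (A (suc a₂))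
    meet (inj₁ refl) = inj₂ (inj₁ (refl , refl))
    meet (inj₂ (inj₁ (e₁ , e₂))) = inj₁ (inj₂ (at e₁) , inj₁ (at e₂))
    meet (inj₂ (inj₂ (e₁ , e₂))) = inj₁ (inj₁ (at e₁) , inj₂ (at e₂))

  alongX-alongX : ∀ {σ₁ a₁ σ₂ a₂ px py} → Dec (σ₁ ≡ σ₂) → 1 ℕ.≤ a₁ →
                  OnStroke (px , py) (onX σ₁ a₁) (onX σ₁ (suc a₁)) → OnStroke (px , py) (onX σ₂ a₂) (onX σ₂ (suc a₂)) →
                  Meets (px , py) (onX σ₁ a₁) (onX σ₁ (suc a₁)) (onX σ₂ a₂) (onX σ₂ (suc a₂))
  alongX-alongX {σ₁} {a₁} {σ₂} {a₂} {px} {py} (no σ₁≢σ₂) 1≤a₁ o₁ o₂ =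
    ⊥-elim (alongX-off-yAxis 1≤a₁ o₁ (signed-opposite px σ₁≢σ₂ (nonNeg o₁) (nonNeg o₂)))
    where
    nonNeg : ∀ {σ a} → OnStroke (px , py) (onX σ a) (onX σ (suc a)) → 0ℚ ≤ signed σ px
    nonNeg {σ} {a} o = ℚ.≤-trans (ι-nonNeg a) (proj₁ (proj₁ (alongX-point {σ} {a} px py o)))
  alongX-alongX {σ} {a₁} {_} {a₂} {px} {py} (yes refl) _ o₁ o₂ =
    axis-strokes-meet (onX σ) (λ eq → on-xAxis σ eq py≡0) lo₁ hi₁ lo₂ hi₂
    where
    py≡0 = proj₂ (alongX-point {σ} {a₁} px py o₁)
    lo₁ = proj₁ (proj₁ (alongX-point {σ} {a₁} px py o₁))
    hi₁ = proj₂ (proj₁ (alongX-point {σ} {a₁} px py o₁))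
    lo₂ = proj₁ (proj₁ (alongX-point {σ} {a₂} px py o₂))
    hi₂ = proj₂ (proj₁ (alongX-point {σ} {a₂} px py o₂))

  alongY-alongY : ∀ {b₁ b₂ px py} →
                  OnStroke (px , py) (onY true b₁) (onY true (suc b₁)) → OnStroke (px , py) (onY true b₂) (onY true (suc b₂)) →
                  Meets (px , py) (onY true b₁) (onY true (suc b₁)) (onY true b₂) (onY true (suc b₂))
  alongY-alongY {b₁} {b₂} {px} {py} o₁ o₂ =
    axis-strokes-meet (onY true) (on-yAxis px≡0) lo₁ hi₁ lo₂ hi₂
    where
    px≡0 = proj₁ (alongY-point {b₁} px py o₁)
    lo₁ = proj₁ (proj₂ (alongY-point {b₁} px py o₁))
    hi₁ = proj₂ (proj₂ (alongY-point {b₁} px py o₁))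
    lo₂ = proj₁ (proj₂ (alongY-point {b₂} px py o₂))
    hi₂ = proj₂ (proj₂ (alongY-point {b₂} px py o₂))

  strokes-meet : ∀ {A₁ B₁ A₂ B₂} → Stroke A₁ B₁ → Stroke A₂ B₂ → ∀ p →
                 OnStroke p A₁ B₁ → OnStroke p A₂ B₂ → Meets p A₁ B₁ A₂ B₂
  strokes-meet (diagonal σ₁ {τ₁} 1≤a₁ 1≤b₁ r₁) (diagonal σ₂ {τ₂} 1≤a₂ 1≤b₂ r₂) (px , py) =
    diagonal-diagonal (σ₁ Data.Bool.≟ σ₂) (τ₁ Data.Bool.≟ τ₂) 1≤a₁ 1≤b₁ r₁ 1≤a₂ 1≤b₂ r₂
  strokes-meet (diagonal σ₁ 1≤a₁ 1≤b₁ r₁) (alongX σ₂ 1≤a₂) (px , py) = diagonal-alongX 1≤b₁ 1≤a₂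
  strokes-meet (diagonal σ₁ 1≤a₁ 1≤b₁ r₁) (alongY 1≤b₂) (px , py) = diagonal-alongY 1≤a₁ 1≤b₂
  strokes-meet (alongX σ₁ 1≤a₁) (diagonal σ₂ 1≤a₂ 1≤b₂ r₂) (px , py) o₁ o₂ =
    meets-sym (diagonal-alongX 1≤b₂ 1≤a₁ o₂ o₁)
  strokes-meet (alongX σ₁ 1≤a₁) (alongX σ₂ 1≤a₂) (px , py) = alongX-alongX (σ₁ Data.Bool.≟ σ₂) 1≤a₁
  strokes-meet (alongX σ₁ 1≤a₁) (alongY 1≤b₂) (px , py) o₁ o₂ =
    ⊥-elim (alongX-off-yAxis 1≤a₁ o₁ (proj₁ (alongY-point px py o₂)))
  strokes-meet (alongY 1≤b₁) (diagonal σ₂ 1≤a₂ 1≤b₂ r₂) (px , py) o₁ o₂ =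
    meets-sym (diagonal-alongY 1≤a₂ 1≤b₁ o₂ o₁)
  strokes-meet (alongY 1≤b₁) (alongX σ₂ 1≤a₂) (px , py) o₁ o₂ =
    ⊥-elim (alongX-off-yAxis 1≤a₂ o₂ (proj₁ (alongY-point px py o₁)))
  strokes-meet (alongY 1≤b₁) (alongY 1≤b₂) (px , py) = alongY-alongY

  stroke-vertex : ∀ {A B} → Stroke A B → ∀ W → AwayFromOrigin W → OnStroke (point W) A B → W ≡ A ⊎ W ≡ B
  stroke-vertex (diagonal σ 1≤a 1≤b r) (onX σ′ c) 1≤c o =
    inj₁ (point-injective _ _ 1≤c 1≤a (diagonal-on-xAxis 1≤b o refl))
  stroke-vertex (diagonal σ 1≤a 1≤b r) (onY τ′ c) 1≤c o =
    inj₂ (point-injective _ _ 1≤c 1≤b (diagonal-on-yAxis 1≤a o refl))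
  stroke-vertex (alongX σ 1≤a) (onX σ′ c) _ o = alongX-vertex 1≤a o
  stroke-vertex (alongX σ 1≤a) (onY τ′ c) _ o = ⊥-elim (alongX-off-yAxis 1≤a o refl)
  stroke-vertex (alongY 1≤b) (onX σ′ c) _ o = ⊥-elim (alongY-off-xAxis 1≤b o refl)
  stroke-vertex (alongY 1≤b) (onY τ′ c) _ o = alongY-vertex 1≤b o

  Drawn : AxisPoint → AxisPoint → Set
  Drawn A B = Stroke A B ⊎ Stroke B A

  stroke-drawn-meet : ∀ {A₁ B₁ A₂ B₂} → Stroke A₁ B₁ → Drawn A₂ B₂ → ∀ p →
                      OnStroke p A₁ B₁ → OnStroke p A₂ B₂ → Meets p A₁ B₁ A₂ B₂
  stroke-drawn-meet s₁ (inj₁ s₂) p o₁ o₂ = strokes-meet s₁ s₂ p o₁ o₂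
  stroke-drawn-meet s₁ (inj₂ s₂) p o₁ o₂ =
    meets-sym (meets-flipˡ (meets-sym (strokes-meet s₁ s₂ p o₁ (OnStroke-swap o₂))))

  drawn-meet : ∀ {A₁ B₁ A₂ B₂} → Drawn A₁ B₁ → Drawn A₂ B₂ → ∀ p →
               OnStroke p A₁ B₁ → OnStroke p A₂ B₂ → Meets p A₁ B₁ A₂ B₂
  drawn-meet (inj₁ s₁) d₂ p o₁ o₂ = stroke-drawn-meet s₁ d₂ p o₁ o₂
  drawn-meet (inj₂ s₁) d₂ p o₁ o₂ = meets-flipˡ (stroke-drawn-meet s₁ d₂ p (OnStroke-swap o₁) o₂)

  drawn-vertex : ∀ {A B} → Drawn A B → ∀ W → AwayFromOrigin W → OnStroke (point W) A B → W ≡ A ⊎ W ≡ B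
  drawn-vertex (inj₁ s) W w o = stroke-vertex s W w o
  drawn-vertex (inj₂ s) W w o = Data.Sum.swap (stroke-vertex s W w (OnStroke-swap o))

  axis-drawing-planar : ∀ {n} (G : Graph n) (f : Fin n → AxisPoint) → Injective _≡_ _≡_ f →
                        (∀ v → AwayFromOrigin (f v)) → (∀ u v → Adj G u v → Drawn (f u) (f v)) → Planar G
  axis-drawing-planar G f f-injective away drawn = record
    { pos       = λ v → point (f v)
    ; pos-inj   = λ {u} {v} eq → f-injective (point-injective (f u) (f v) (away u) (away v) eq)
    ; vertexOff = λ a b w a~b o →
        Data.Sum.map f-injective f-injective (drawn-vertex (drawn a b a~b) (f w) (away w) (onStroke o))
    ; noCross   = λ a b c d a~b c~d not-same p o₁ o₂ →
        common-end not-same (drawn-meet (drawn a b a~b) (drawn c d c~d) p (onStroke o₁) (onStroke o₂))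
    }
    where
    common-end : ∀ {a b c d p} → ¬ ((a ≡ c × b ≡ d) ⊎ (a ≡ d × b ≡ c)) → Meets p (f a) (f b) (f c) (f d) →
                 Ends p (f a) (f b) × Ends p (f c) (f d)
    common-end _ (inj₁ ends) = ends
    common-end not-same (inj₂ (inj₁ (a≡c , b≡d))) = ⊥-elim (not-same (inj₁ (f-injective a≡c , f-injective b≡d)))
    common-end not-same (inj₂ (inj₂ (a≡d , b≡c))) = ⊥-elim (not-same (inj₂ (f-injective a≡d , f-injective b≡c)))

module FiveCycle where
  open import Data.Bool using (Bool; _∧_; _∨_; T; T?)
  open import Data.Bool.Properties using (T-∧; ∨-comm)
  open import Data.Empty using (⊥)
  open import Data.Fin using (Fin; toℕ)
  import Data.Fin.Properties as Fin
  open import Data.Nat using (suc; _≡ᵇ_; _%_)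
  open import Data.Product using (_,_)
  open import Function.Bundles using (module Equivalence)
  open import Relation.Binary.PropositionalEquality using (subst)
  open import Relation.Nullary using (¬_)
  open import Relation.Nullary.Decidable using (toWitness; ¬?)

  open Equivalence using (from)

  c5 : Fin 5 → Fin 5 → Bool
  c5 i j = (suc (toℕ i) % 5 ≡ᵇ toℕ j) ∨ (suc (toℕ j) % 5 ≡ᵇ toℕ i)

  c5-sym : ∀ i j → T (c5 i j) → T (c5 j i)
  c5-sym i j = subst T (∨-comm (suc (toℕ i) % 5 ≡ᵇ toℕ j) (suc (toℕ j) % 5 ≡ᵇ toℕ i))

  c5-triangle-free : ∀ i j k → T (c5 i j) → T (c5 j k) → T (c5 k i) → ⊥
  c5-triangle-free i j k ij jk ki = no-triangle i j k (from T-∧ (ij , from T-∧ (jk , ki)))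
    where
    no-triangle : ∀ i j k → ¬ T (c5 i j ∧ (c5 j k ∧ c5 k i))
    no-triangle = toWitness {a? = Fin.all? λ i → Fin.all? λ j → Fin.all? λ k → ¬? (T? _)} _

module ListGraph {Code : Set} (vs : List Code) (adjC : Code → Code → Bool)
                 (adjC-sym : ∀ a b → adjC a b ≡ adjC b a) (adjC-irrefl : ∀ a → adjC a a ≡ false) where
  open import Data.Bool using (Bool; false)
  open import Data.List using (List; length; lookup; allFin)
  open import Data.List.Properties using (map-tabulate; tabulate-lookup)
  open import Relation.Binary.PropositionalEquality

  open import Defs using (Graph; degree)
  open Lists using (count; count-map)

  graph : Graph (length vs)
  graph = record
    { adj = λ u v → adjC (lookup vs u) (lookup vs v)
    ; sym = λ u v → adjC-sym (lookup vs u) (lookup vs v)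
    ; irrefl = λ v → adjC-irrefl (lookup vs v)
    }

  degree-graph : ∀ v → degree graph v ≡ count (adjC (lookup vs v)) vs
  degree-graph v =
    trans (sym (count-map (adjC (lookup vs v)) (lookup vs) (allFin (length vs))))
          (cong (count (adjC (lookup vs v))) (trans (map-tabulate (λ i → i) (lookup vs)) (tabulate-lookup vs)))

module Strip where
  open import Data.Bool using (Bool; true; false; not; _∧_; _∨_; T; if_then_else_)
  open import Data.Bool.Properties using (T-∧; ∨-comm)
  open import Data.Fin using (Fin; #_)
  open import Data.List using (List; []; _∷_; _++_; map; length)
  open import Data.Nat using (ℕ; zero; suc; _+_; _*_; _≤_; _<_; s≤s; _≡ᵇ_)
  open import Data.Nat.Properties using (≡ᵇ⇒≡)
  open import Data.Product using (_,_)
  open import Function.Bundles using (module Equivalence)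
  open import Relation.Binary.PropositionalEquality

  open FiveCycle using (c5)
  open Lists using (⟦_⟧; count; count-++; interval; map-interval-suc)

  open Equivalence using (from)

  -- Each slot of the strip has a kind; the Bool of an end-gadget kind selects its variant.
  data Kind : Set where
    none : Kind
    low₁ low₂ low₃ : Bool → Kind
    mid₀ mid₁ : Kind
    high₁ high₂ : Bool → Kind
    high₃ high₄ : Kind

  -- Vertex at (0, p) on the spine, at (p, 0) on the east, at (-p, 0) on the west.
  data Column : Set where
    spine east west : Column

  present : Column → Kind → Bool
  present _ none = false
  present spine high₄ = false
  present spine _ = true
  present east _ = true
  present west (low₁ e) = e
  present west mid₀ = false
  present west (high₁ t) = t
  present west high₄ = false
  present west _ = true

  toHub : Column → Kind → Bool
  toHub spine _ = false
  toHub east (low₂ _) = false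
  toHub east high₃ = false
  toHub east none = false
  toHub east _ = true
  toHub west (low₁ e) = e
  toHub west (low₂ e) = not e
  toHub west (low₃ e) = e
  toHub west mid₁ = true
  toHub west (high₁ t) = t
  toHub west high₃ = true
  toHub west _ = false

  spoke : Column → Kind → Bool
  spoke d κ = present d κ ∧ toHub d κ

  across : Column → Column → Kind → Bool
  across spine east (low₁ _) = true
  across spine east (low₂ _) = true
  across spine east (low₃ _) = true
  across spine east mid₀ = true
  across spine east mid₁ = true
  across spine east (high₁ _) = true
  across spine west (low₁ e) = e
  across spine west (low₂ e) = e
  across spine west (low₃ _) = true
  across spine west mid₁ = true
  across spine west (high₁ t) = t
  across spine west (high₂ _) = true
  across spine west high₃ = true
  across _ _ _ = false

  step : Column → Column → Kind → Kind → Bool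
  step spine spine (low₁ _) _ = true
  step spine spine (high₂ _) _ = true
  step east east (low₁ _) _ = true
  step east east (low₂ _) _ = true
  step east east (high₂ _) _ = true
  step east east high₃ _ = true
  step west west (low₁ e) _ = e
  step west west (low₂ _) _ = true
  step west west (high₁ t) _ = t
  step west west (high₂ _) _ = true
  step spine east _ mid₀ = true
  step spine east _ mid₁ = true
  step spine east _ (high₁ _) = true
  step spine east _ (high₂ _) = true
  step spine east _ high₃ = true
  step spine east _ high₄ = true
  step spine west _ (low₂ e) = not e
  step spine west _ (low₃ e) = not e
  step spine west _ mid₁ = true
  step spine west _ (high₂ t) = not t
  step _ _ _ _ = false

  -- A homomorphism to C₅ (the hub goes to 0), found by a computer search.
  colour : Column → Kind → Fin 5
  colour spine (low₂ _) = # 1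
  colour spine (low₃ e) = if e then # 0 else # 3
  colour spine (high₁ t) = if t then # 0 else # 3
  colour spine (high₂ _) = # 1
  colour spine _ = # 0
  colour east (low₂ _) = # 0
  colour east (low₃ e) = if e then # 1 else # 4
  colour east mid₀ = # 4
  colour east (high₁ t) = if t then # 1 else # 4
  colour east (high₂ t) = if t then # 1 else # 4
  colour east high₃ = # 0
  colour east _ = # 1
  colour west (low₂ e) = if e then # 0 else # 1
  colour west (low₃ e) = if e then # 1 else # 2
  colour west (high₂ t) = if t then # 0 else # 2
  colour west none = # 0
  colour west mid₀ = # 0
  colour west high₄ = # 0
  colour west _ = # 1

  data Offset : Set where
    below same above far : Offset

  flip : Offset → Offset
  flip below = above
  flip same = same
  flip above = below
  flip far = far

  near : ℕ → ℕ → Offset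
  near zero zero = same
  near zero (suc zero) = above
  near zero (suc (suc _)) = far
  near (suc p) (suc x) = near p x
  near (suc zero) zero = below
  near (suc (suc _)) zero = far

  near-flip : ∀ p x → near x p ≡ flip (near p x)
  near-flip zero zero = refl
  near-flip zero (suc zero) = refl
  near-flip zero (suc (suc x)) = refl
  near-flip (suc p) (suc x) = near-flip p x
  near-flip (suc zero) zero = refl
  near-flip (suc (suc p)) zero = refl

  near-same : ∀ p → near p p ≡ same
  near-same zero = refl
  near-same (suc p) = near-same p

  near-above : ∀ p → near p (suc p) ≡ above
  near-above zero = refl
  near-above (suc p) = near-above p

  near-below : ∀ p → near (suc p) p ≡ below
  near-below p = trans (near-flip p (suc p)) (cong flip (near-above p))

  near-far-below : ∀ p x → suc x < p → near p x ≡ far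
  near-far-below (suc (suc p)) zero _ = refl
  near-far-below (suc p) (suc x) (s≤s 2+x≤p) = near-far-below p x 2+x≤p

  near-far-above : ∀ p x → suc p < x → near p x ≡ far
  near-far-above p x 2+p≤x = trans (near-flip x p) (cong flip (near-far-below x p 2+p≤x))

  data NearView : ℕ → ℕ → Offset → Set where
    is-same  : ∀ p → NearView p p same
    is-above : ∀ p → NearView p (suc p) above
    is-below : ∀ x → NearView (suc x) x below
    is-far   : ∀ {p x} → NearView p x far

  near-view : ∀ p x → NearView p x (near p x)
  near-view zero zero = is-same zero
  near-view zero (suc zero) = is-above zero
  near-view zero (suc (suc x)) = is-far
  near-view (suc zero) zero = is-below zero
  near-view (suc (suc p)) zero = is-far
  near-view (suc p) (suc x) = shift (near-view p x)
    where
    shift : ∀ {p x o} → NearView p x o → NearView (suc p) (suc x) o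
    shift (is-same p) = is-same (suc p)
    shift (is-above p) = is-above (suc p)
    shift (is-below x) = is-below (suc x)
    shift is-far = is-far

  link : Column → Column → Offset → Kind → Kind → Bool
  link c d below κ κ′ = step d c κ′ κ
  link c d same κ κ′ = across c d κ ∨ across d c κ′
  link c d above κ κ′ = step c d κ κ′
  link c d far _ _ = false

  link-flip : ∀ c d o κ κ′ → link d c (flip o) κ′ κ ≡ link c d o κ κ′
  link-flip c d below κ κ′ = refl
  link-flip c d same κ κ′ = ∨-comm (across d c κ′) (across c d κ)
  link-flip c d above κ κ′ = refl
  link-flip c d far κ κ′ = refl

  columnSum : (Column → ℕ) → ℕ
  columnSum f = f spine + (f east + f west)

  allColumns : (Column → Bool) → Bool
  allColumns f = f spine ∧ (f east ∧ f west)

  ∧-fst : ∀ a {b} → T (a ∧ b) → T a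
  ∧-fst true _ = _

  ∧-snd : ∀ a {b} → T (a ∧ b) → T b
  ∧-snd true h = h

  allColumns-elim : ∀ {f} → T (allColumns f) → ∀ c → T (f c)
  allColumns-elim {f} h spine = ∧-fst (f spine) h
  allColumns-elim {f} h east = ∧-fst (f east) (∧-snd (f spine) h)
  allColumns-elim {f} h west = ∧-snd (f east) (∧-snd (f spine) h)

  neighboursIn : Column → Column → Kind → Kind → Kind → ℕ
  neighboursIn c d κ₋ κ κ₊ =
    ⟦ present d κ₋ ∧ link c d below κ κ₋ ⟧ +
    (⟦ present d κ ∧ link c d same κ κ ⟧ + ⟦ present d κ₊ ∧ link c d above κ κ₊ ⟧)

  localDegree : Column → Kind → Kind → Kind → ℕ
  localDegree c κ₋ κ κ₊ = ⟦ toHub c κ ⟧ + columnSum (λ d → neighboursIn c d κ₋ κ κ₊)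

  _⇒ᵇ_ : Bool → Bool → Bool
  a ⇒ᵇ b = not a ∨ b

  ⇒ᵇ-elim : ∀ {a b} → T (a ⇒ᵇ b) → T a → T b
  ⇒ᵇ-elim {true} h _ = h

  degreeOK : Kind → Kind → Kind → Column → Bool
  degreeOK κ₋ κ κ₊ c = present c κ ⇒ᵇ (localDegree c κ₋ κ κ₊ ≡ᵇ 3)

  spokeOK : Kind → Column → Bool
  spokeOK κ d = spoke d κ ⇒ᵇ c5 (# 0) (colour d κ)

  acrossOK : Kind → Column → Column → Bool
  acrossOK κ c d = (present c κ ∧ (present d κ ∧ across c d κ)) ⇒ᵇ c5 (colour c κ) (colour d κ)

  stepOK : Kind → Kind → Column → Column → Bool
  stepOK κ κ′ c d = (present c κ ∧ (present d κ′ ∧ step c d κ κ′)) ⇒ᵇ c5 (colour c κ) (colour d κ′)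

  windowOK : Kind → Kind → Kind → Bool
  windowOK κ₋ κ κ₊ =
    allColumns (degreeOK κ₋ κ κ₊) ∧
    (allColumns (spokeOK κ₋) ∧
     (allColumns (λ c → allColumns (acrossOK κ₋ c)) ∧ allColumns (λ c → allColumns (stepOK κ₋ κ c))))

  record WindowFacts (κ₋ κ κ₊ : Kind) : Set where
    field
      middle-degree : ∀ c → T (present c κ) → localDegree c κ₋ κ κ₊ ≡ 3
      spoke-colour  : ∀ d → T (present d κ₋) → T (toHub d κ₋) → T (c5 (# 0) (colour d κ₋))
      across-colour : ∀ c d → T (present c κ₋) → T (present d κ₋) → T (across c d κ₋) →
                      T (c5 (colour c κ₋) (colour d κ₋))
      step-colour   : ∀ c d → T (present c κ₋) → T (present d κ) → T (step c d κ₋ κ) →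
                      T (c5 (colour c κ₋) (colour d κ))

  window-facts : ∀ κ₋ κ κ₊ → T (windowOK κ₋ κ κ₊) → WindowFacts κ₋ κ κ₊
  window-facts κ₋ κ κ₊ ok = record
    { middle-degree = λ c pres → ≡ᵇ⇒≡ _ 3 (⇒ᵇ-elim (allColumns-elim {degreeOK κ₋ κ κ₊} degrees c) pres)
    ; spoke-colour  = λ d pres spoke → ⇒ᵇ-elim (allColumns-elim {spokeOK κ₋} spokes d) (from T-∧ (pres , spoke))
    ; across-colour = λ c d pc pd edge →
        ⇒ᵇ-elim (allColumns-elim {acrossOK κ₋ c} (allColumns-elim {λ c → allColumns (acrossOK κ₋ c)} acrosses c) d)
                (from T-∧ (pc , from T-∧ (pd , edge)))
    ; step-colour   = λ c d pc pd edge →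
        ⇒ᵇ-elim (allColumns-elim {stepOK κ₋ κ c} (allColumns-elim {λ c → allColumns (stepOK κ₋ κ c)} steps c) d)
                (from T-∧ (pc , from T-∧ (pd , edge)))
    }
    where
    degrees : T (allColumns (degreeOK κ₋ κ κ₊))
    degrees = ∧-fst (allColumns (degreeOK κ₋ κ κ₊)) ok
    colours : T (allColumns (spokeOK κ₋) ∧
                 (allColumns (λ c → allColumns (acrossOK κ₋ c)) ∧ allColumns (λ c → allColumns (stepOK κ₋ κ c))))
    colours = ∧-snd (allColumns (degreeOK κ₋ κ κ₊)) ok
    spokes : T (allColumns (spokeOK κ₋))
    spokes = ∧-fst (allColumns (spokeOK κ₋)) colours
    edges : T (allColumns (λ c → allColumns (acrossOK κ₋ c)) ∧ allColumns (λ c → allColumns (stepOK κ₋ κ c)))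
    edges = ∧-snd (allColumns (spokeOK κ₋)) colours
    acrosses : T (allColumns (λ c → allColumns (acrossOK κ₋ c)))
    acrosses = ∧-fst (allColumns (λ c → allColumns (acrossOK κ₋ c))) edges
    steps : T (allColumns (λ c → allColumns (stepOK κ₋ κ c)))
    steps = ∧-snd (allColumns (λ c → allColumns (acrossOK κ₋ c))) edges

  windowsOK : List Kind → Bool
  windowsOK (a ∷ b ∷ c ∷ w) = windowOK a b c ∧ windowsOK (b ∷ c ∷ w)
  windowsOK _ = true

  windowsOK-tail : ∀ κ w → T (windowsOK (κ ∷ w)) → T (windowsOK w)
  windowsOK-tail κ [] _ = _
  windowsOK-tail κ (b ∷ []) _ = _
  windowsOK-tail κ (b ∷ c ∷ w) h = ∧-snd (windowOK κ b c) h

  kindAt : List Kind → ℕ → Kind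
  kindAt [] _ = none
  kindAt (κ ∷ _) zero = κ
  kindAt (_ ∷ w) (suc p) = kindAt w p

  kindAt-beyond : ∀ w p → length w ≤ p → kindAt w p ≡ none
  kindAt-beyond [] p _ = refl
  kindAt-beyond (κ ∷ w) (suc p) (s≤s w≤p) = kindAt-beyond w p w≤p

  map-kindAt : ∀ w → map (kindAt w) (interval 0 (length w)) ≡ w
  map-kindAt [] = refl
  map-kindAt (κ ∷ w) = cong (κ ∷_) (trans (map-interval-suc (kindAt (κ ∷ w)) 0 (length w)) (map-kindAt w))

  padding : List Kind
  padding = none ∷ none ∷ []

  -- Past its end a word reads as none, and windowOK none none none holds.
  window-at : ∀ w q → T (windowsOK (w ++ padding)) →
              T (windowOK (kindAt w q) (kindAt w (suc q)) (kindAt w (2 + q)))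
  window-at [] q _ = _
  window-at (a ∷ []) zero h = ∧-fst (windowOK a none none) h
  window-at (a ∷ b ∷ []) zero h = ∧-fst (windowOK a b none) h
  window-at (a ∷ b ∷ c ∷ w) zero h = ∧-fst (windowOK a b c) h
  window-at (a ∷ w) (suc q) h = window-at w q (windowsOK-tail a (w ++ padding) h)

  -- Slot 0 stays empty, which keeps every vertex off the origin.
  bottom : Bool → List Kind
  bottom e = none ∷ low₁ e ∷ low₂ e ∷ low₃ e ∷ []

  pairs : ℕ → List Kind
  pairs zero = []
  pairs (suc j) = mid₀ ∷ mid₁ ∷ pairs j

  top : Bool → List Kind
  top t = high₁ t ∷ high₂ t ∷ high₃ ∷ high₄ ∷ []

  layout : ℕ → Bool → Bool → List Kind
  layout k e t = bottom e ++ pairs (2 + k) ++ top t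

  pairs-windows : ∀ t k → T (windowsOK (mid₀ ∷ mid₁ ∷ (pairs k ++ top t) ++ padding))
  pairs-windows false zero = _
  pairs-windows true zero = _
  pairs-windows t (suc k) = pairs-windows t k

  layout-windows : ∀ k e t → T (windowsOK (layout k e t ++ padding))
  layout-windows k false t = pairs-windows t (suc k)
  layout-windows k true t = pairs-windows t (suc k)

  count-layout : ∀ (P : Kind → Bool) k e t →
                 count P (layout k e t) ≡ count P (bottom e) + ((2 + k) * count P (pairs 1) + count P (top t))
  count-layout P k e t =
    trans (count-++ P (bottom e) _) (cong (count P (bottom e) +_) (trans (count-++ P (pairs (2 + k)) _)
          (cong (_+ count P (top t)) (count-pairs (2 + k)))))
    where
    count-pairs : ∀ j → count P (pairs j) ≡ j * count P (pairs 1)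
    count-pairs zero = refl
    count-pairs (suc j) = trans (count-++ P (pairs 1) (pairs j)) (cong (count P (pairs 1) +_) (count-pairs j))

  data Code : Set where
    hub : Code
    at : Column → ℕ → Code

module StripGraph (k : ℕ) (e t : Bool) where
  open import Data.Bool using (Bool; true; false; _∧_; _∨_; T; T?)
  open import Data.Bool.Properties using (T-∨; T-≡; ∧-zeroʳ)
  open import Data.Empty using (⊥-elim)
  open import Data.Fin using (Fin; zero; suc; #_; inject₁)
  open import Data.List using (List; []; _∷_; _++_; map; filterᵇ; length; lookup)
  open import Data.List.Membership.Propositional using (_∈_; _∉_)
  open import Data.List.Membership.Propositional.Properties
    using (∈-++⁻; ∈-++⁺ˡ; ∈-++⁺ʳ; ∈-map⁻; ∈-map⁺; ∈-filter⁻; ∈-filter⁺; ∈-lookup)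
  open import Data.List.Properties using (length-++; length-map)
  open import Data.List.Relation.Binary.Disjoint.Propositional using (Disjoint)
  open import Data.List.Relation.Unary.All as All using ()
  open import Data.List.Relation.Unary.AllPairs using ([]; _∷_)
  open import Data.List.Relation.Unary.Any using (here; there; index)
  open import Data.List.Relation.Unary.Any.Properties using (lookup-index)
  open import Data.List.Relation.Unary.Unique.Propositional using (Unique)
  import Data.List.Relation.Unary.Unique.Propositional.Properties as Unique
  open import Data.Nat as ℕ using (ℕ; zero; suc; _+_; _*_; _≤_; _<_; z≤n; s≤s)
  import Data.Nat.Properties as ℕ
  import Data.Nat.Solver
  open import Data.Product using (Σ; _×_; _,_; proj₁; proj₂)
  open import Data.Sum using (_⊎_; inj₁; inj₂)
  open import Function using (_∘_)
  open import Function.Bundles using (module Equivalence)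
  open import Function.Definitions using (Injective)
  open import Relation.Binary.PropositionalEquality
  open import Relation.Nullary using (¬_)

  open import Defs using (Graph; Adj; degree; HasCycle; IsRMGraph; Planar)
  open FiveCycle
  open Geometry
    using (axis-drawing-planar; AxisPoint; onX; onY; AwayFromOrigin; Drawn; diagonal; alongX; alongY; level; slanted; hubward)
  open Lists
  open Strip

  module ℕ-Solver = Data.Nat.Solver.+-*-Solver
  open Equivalence using (to; from)
  open WindowFacts

  kind : ℕ → Kind
  kind = kindAt (layout k e t)

  N : ℕ
  N = length (layout k e t)

  window : ∀ q → WindowFacts (kind q) (kind (suc q)) (kind (2 + q))
  window q = window-facts _ _ _ (window-at (layout k e t) q (layout-windows k e t))

  absent-beyond : ∀ c x → N ≤ x → present c (kind x) ≡ false
  absent-beyond c x N≤x rewrite kindAt-beyond (layout k e t) x N≤x = none-absent c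
    where
    none-absent : ∀ c → present c none ≡ false
    none-absent spine = refl
    none-absent east = refl
    none-absent west = refl

  present⇒inside : ∀ c x → T (present c (kind x)) → x < N
  present⇒inside c x pres with ℕ.≤-<-connex N x
  ... | inj₁ N≤x = ⊥-elim (subst T (absent-beyond c x N≤x) pres)
  ... | inj₂ x<N = x<N

  present⇒positive : ∀ c x → T (present c (kind x)) → 1 ≤ x
  present⇒positive spine (suc x) _ = s≤s z≤n
  present⇒positive east (suc x) _ = s≤s z≤n
  present⇒positive west (suc x) _ = s≤s z≤n

  adjC : Code → Code → Bool
  adjC hub hub = false
  adjC hub (at d x) = toHub d (kind x)
  adjC (at c p) hub = toHub c (kind p)
  adjC (at c p) (at d x) = link c d (near p x) (kind p) (kind x)

  adjC-sym : ∀ a b → adjC a b ≡ adjC b a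
  adjC-sym hub hub = refl
  adjC-sym hub (at d x) = refl
  adjC-sym (at c p) hub = refl
  adjC-sym (at c p) (at d x) =
    sym (trans (cong (λ o → link d c o (kind x) (kind p)) (near-flip p x)) (link-flip c d (near p x) (kind p) (kind x)))

  adjC-irrefl : ∀ a → adjC a a ≡ false
  adjC-irrefl hub = refl
  adjC-irrefl (at c p) rewrite near-same p = no-loop c
    where
    no-loop : ∀ c → across c c (kind p) ∨ across c c (kind p) ≡ false
    no-loop spine = refl
    no-loop east = refl
    no-loop west = refl

  column : Column → List Code
  column c = map (at c) (filterᵇ (present c ∘ kind) (interval 0 N))

  columns : List Code
  columns = column spine ++ column east ++ column west

  vertices : List Code
  vertices = hub ∷ columns

  open ListGraph vertices adjC adjC-sym adjC-irrefl public

  data Vertex : Code → Set where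
    hub : Vertex hub
    at : ∀ c p → T (present c (kind p)) → Vertex (at c p)

  column-vertex : ∀ c {v} → v ∈ column c → Vertex v
  column-vertex c v∈ with ∈-map⁻ (at c) v∈
  ... | p , p∈ , refl = at c p (proj₂ (∈-filter⁻ (T? ∘ present c ∘ kind) {xs = interval 0 N} p∈))

  in-some-column : ∀ {v} → v ∈ columns → Σ Column λ c → v ∈ column c
  in-some-column v∈ with ∈-++⁻ (column spine) v∈
  ... | inj₁ v∈s = spine , v∈s
  ... | inj₂ v∈ew with ∈-++⁻ (column east) v∈ew
  ...   | inj₁ v∈e = east , v∈e
  ...   | inj₂ v∈w = west , v∈w

  vertex : ∀ {v} → v ∈ vertices → Vertex v
  vertex (here refl) = hub
  vertex (there v∈) = column-vertex (proj₁ (in-some-column v∈)) (proj₂ (in-some-column v∈))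

  ∈-column : ∀ c p → T (present c (kind p)) → at c p ∈ column c
  ∈-column c p pres =
    ∈-map⁺ (at c) (∈-filter⁺ (T? ∘ present c ∘ kind) (∈-interval 0 N z≤n (present⇒inside c p pres)) pres)

  ∈-vertices : ∀ c p → T (present c (kind p)) → at c p ∈ vertices
  ∈-vertices spine p pres = there (∈-++⁺ˡ (∈-column spine p pres))
  ∈-vertices east p pres = there (∈-++⁺ʳ (column spine) (∈-++⁺ˡ (∈-column east p pres)))
  ∈-vertices west p pres = there (∈-++⁺ʳ (column spine) (∈-++⁺ʳ (column east) (∈-column west p pres)))

  hub∉column : ∀ c → hub ∉ column c
  hub∉column c hub∈ with ∈-map⁻ (at c) hub∈
  ... | _ , _ , ()

  hub∉columns : hub ∉ columns
  hub∉columns hub∈ = hub∉column (proj₁ (in-some-column hub∈)) (proj₂ (in-some-column hub∈))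

  column-unique : ∀ c → Unique (column c)
  column-unique c = Unique.map⁺ at-injective (Unique.filter⁺ (T? ∘ present c ∘ kind) (interval-unique 0 N))
    where
    at-injective : ∀ {p q} → at c p ≡ at c q → p ≡ q
    at-injective refl = refl

  columns-disjoint : ∀ {c d} → c ≢ d → Disjoint (column c) (column d)
  columns-disjoint {c} {d} c≢d (v∈c , v∈d) with ∈-map⁻ (at c) v∈c | ∈-map⁻ (at d) v∈d
  ... | _ , _ , refl | _ , _ , refl = c≢d refl

  vertices-unique : Unique vertices
  vertices-unique =
    All.tabulate (λ v∈ hub≡v → hub∉columns (subst (_∈ columns) (sym hub≡v) v∈)) ∷
    Unique.++⁺ (column-unique spine)
               (Unique.++⁺ (column-unique east) (column-unique west) (columns-disjoint {east} {west} λ ()))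
               spine-disjoint
    where
    spine-disjoint : Disjoint (column spine) (column east ++ column west)
    spine-disjoint (v∈s , v∈ew) with ∈-++⁻ (column east) v∈ew
    ... | inj₁ v∈e = columns-disjoint {spine} {east} (λ ()) (v∈s , v∈e)
    ... | inj₂ v∈w = columns-disjoint {spine} {west} (λ ()) (v∈s , v∈w)

  columnSum-cong : ∀ {f g} → (∀ d → f d ≡ g d) → columnSum f ≡ columnSum g
  columnSum-cong f≗g = cong₂ _+_ (f≗g spine) (cong₂ _+_ (f≗g east) (f≗g west))

  column-count : ∀ (P : Code → Bool) d →
                 count P (column d) ≡ count (λ x → present d (kind x) ∧ P (at d x)) (interval 0 N)
  column-count P d = trans (count-map P (at d) (filterᵇ (present d ∘ kind) (interval 0 N)))
                           (count-filter (P ∘ at d) (present d ∘ kind) (interval 0 N))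

  vertices-count : ∀ (P : Code → Bool) →
                   count P vertices ≡ ⟦ P hub ⟧ + columnSum (λ d → count (λ x → present d (kind x) ∧ P (at d x)) (interval 0 N))
  vertices-count P =
    trans (count-∷ P hub columns) (cong (⟦ P hub ⟧ +_)
      (trans (count-++ P (column spine) _) (cong₂ _+_ (column-count P spine)
        (trans (count-++ P (column east) _) (cong₂ _+_ (column-count P east) (column-count P west))))))

  neighbours-count : ∀ c d q →
    count (λ x → present d (kind x) ∧ adjC (at c (suc q)) (at d x)) (interval 0 N) ≡
    neighboursIn c d (kind q) (kind (suc q)) (kind (2 + q))
  neighbours-count c d q = trans (count-window _ N q beyond outside) values
    where
    beyond : ∀ x → N ≤ x → present d (kind x) ∧ adjC (at c (suc q)) (at d x) ≡ false
    beyond x N≤x = cong (_∧ adjC (at c (suc q)) (at d x)) (absent-beyond d x N≤x)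
    far-false : ∀ x → near (suc q) x ≡ far → present d (kind x) ∧ adjC (at c (suc q)) (at d x) ≡ false
    far-false x far≡ = trans (cong (λ o → present d (kind x) ∧ link c d o (kind (suc q)) (kind x)) far≡)
                             (∧-zeroʳ (present d (kind x)))
    outside : ∀ x → x ℕ.< q ⊎ 3 + q ≤ x → present d (kind x) ∧ adjC (at c (suc q)) (at d x) ≡ false
    outside x (inj₁ x<q) = far-false x (near-far-below (suc q) x (s≤s x<q))
    outside x (inj₂ 3+q≤x) = far-false x (near-far-above (suc q) x 3+q≤x)
    values : ⟦ present d (kind q) ∧ adjC (at c (suc q)) (at d q) ⟧ +
             (⟦ present d (kind (suc q)) ∧ adjC (at c (suc q)) (at d (suc q)) ⟧ +
              ⟦ present d (kind (2 + q)) ∧ adjC (at c (suc q)) (at d (2 + q)) ⟧) ≡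
             neighboursIn c d (kind q) (kind (suc q)) (kind (2 + q))
    values rewrite near-below q | near-same (suc q) | near-above (suc q) = refl

  degree-at : ∀ c q → count (adjC (at c (suc q))) vertices ≡ localDegree c (kind q) (kind (suc q)) (kind (2 + q))
  degree-at c q = trans (vertices-count (adjC (at c (suc q))))
                        (cong (⟦ toHub c (kind (suc q)) ⟧ +_) (columnSum-cong λ d → neighbours-count c d q))

  degree-three : ∀ c q → T (present c (kind (suc q))) → count (adjC (at c (suc q))) vertices ≡ 3
  degree-three c q pres =
    trans (degree-at c q) (middle-degree (window q) c pres)

  count-slots : ∀ (P : Kind → Bool) → count (P ∘ kind) (interval 0 N) ≡ count P (layout k e t)
  count-slots P = trans (sym (count-map P kind (interval 0 N))) (cong (count P) (map-kindAt (layout k e t)))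

  columnSum-layout : ∀ (P : Column → Kind → Bool) →
    columnSum (λ d → count (P d ∘ kind) (interval 0 N)) ≡
    columnSum (λ d → count (P d) (bottom e)) +
    ((2 + k) * columnSum (λ d → count (P d) (pairs 1)) + columnSum (λ d → count (P d) (top t)))
  columnSum-layout P =
    trans (columnSum-cong λ d → trans (count-slots (P d)) (count-layout (P d) k e t))
          (regroup (count (P spine) (bottom e)) (count (P east) (bottom e)) (count (P west) (bottom e))
                   (count (P spine) (pairs 1)) (count (P east) (pairs 1)) (count (P west) (pairs 1))
                   (count (P spine) (top t)) (count (P east) (top t)) (count (P west) (top t)) (2 + k))
    where
    open ℕ-Solver using (solve; _:+_; _:*_; _:=_; con)
    regroup : ∀ b₁ b₂ b₃ m₁ m₂ m₃ t₁ t₂ t₃ j →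
              (b₁ + (j * m₁ + t₁)) + ((b₂ + (j * m₂ + t₂)) + (b₃ + (j * m₃ + t₃))) ≡
              (b₁ + (b₂ + b₃)) + (j * (m₁ + (m₂ + m₃)) + (t₁ + (t₂ + t₃)))
    regroup = solve 10 (λ b₁ b₂ b₃ m₁ m₂ m₃ t₁ t₂ t₃ j →
              (b₁ :+ (j :* m₁ :+ t₁)) :+ ((b₂ :+ (j :* m₂ :+ t₂)) :+ (b₃ :+ (j :* m₃ :+ t₃))) :=
              (b₁ :+ (b₂ :+ b₃)) :+ (j :* (m₁ :+ (m₂ :+ m₃)) :+ (t₁ :+ (t₂ :+ t₃)))) refl

  hubDegree : ℕ
  hubDegree = 13 + (3 * k + ⟦ e ⟧ + ⟦ t ⟧)

  degree-hub : count (adjC hub) vertices ≡ hubDegree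
  degree-hub = begin
    count (adjC hub) vertices
      ≡⟨ vertices-count (adjC hub) ⟩
    columnSum (λ d → count (spoke d ∘ kind) (interval 0 N))
      ≡⟨ columnSum-layout spoke ⟩
    columnSum (λ d → count (spoke d) (bottom e)) + ((2 + k) * 3 + columnSum (λ d → count (spoke d) (top t)))
      ≡⟨ cong₂ (λ b t′ → b + ((2 + k) * 3 + t′)) (bottom-spokes e) (top-spokes t) ⟩
    3 + ⟦ e ⟧ + ((2 + k) * 3 + (4 + ⟦ t ⟧))
      ≡⟨ solve 3 (λ k a b → con 3 :+ a :+ ((con 2 :+ k) :* con 3 :+ (con 4 :+ b)) := con 13 :+ (con 3 :* k :+ a :+ b))
                 refl k ⟦ e ⟧ ⟦ t ⟧ ⟩
    hubDegree ∎
    where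
    open ≡-Reasoning
    open ℕ-Solver using (solve; _:+_; _:*_; _:=_; con)
    bottom-spokes : ∀ e → columnSum (λ d → count (spoke d) (bottom e)) ≡ 3 + ⟦ e ⟧
    bottom-spokes false = refl
    bottom-spokes true = refl
    top-spokes : ∀ t → columnSum (λ d → count (spoke d) (top t)) ≡ 4 + ⟦ t ⟧
    top-spokes false = refl
    top-spokes true = refl

  order : ℕ
  order = 28 + (5 * k + ⟦ e ⟧ + ⟦ t ⟧)

  length-vertices : length vertices ≡ order
  length-vertices = cong suc (begin
    length columns
      ≡⟨ length-++ (column spine) ⟩
    length (column spine) + length (column east ++ column west)
      ≡⟨ cong (length (column spine) +_) (length-++ (column east)) ⟩
    columnSum (λ d → length (column d))
      ≡⟨ columnSum-cong {λ d → length (column d)} (λ d → length-map (at d) (filterᵇ (present d ∘ kind) (interval 0 N))) ⟩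
    columnSum (λ d → count (present d ∘ kind) (interval 0 N))
      ≡⟨ columnSum-layout present ⟩
    columnSum (λ d → count (present d) (bottom e)) + ((2 + k) * 5 + columnSum (λ d → count (present d) (top t)))
      ≡⟨ cong₂ (λ b t′ → b + ((2 + k) * 5 + t′)) (bottom-size e) (top-size t) ⟩
    8 + ⟦ e ⟧ + ((2 + k) * 5 + (9 + ⟦ t ⟧))
      ≡⟨ solve 3 (λ k a b → con 8 :+ a :+ ((con 2 :+ k) :* con 5 :+ (con 9 :+ b)) := con 27 :+ (con 5 :* k :+ a :+ b))
                 refl k ⟦ e ⟧ ⟦ t ⟧ ⟩
    27 + (5 * k + ⟦ e ⟧ + ⟦ t ⟧) ∎)
    where
    open ≡-Reasoning
    open ℕ-Solver using (solve; _:+_; _:*_; _:=_; con)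
    bottom-size : ∀ e → columnSum (λ d → count (present d) (bottom e)) ≡ 8 + ⟦ e ⟧
    bottom-size false = refl
    bottom-size true = refl
    top-size : ∀ t → columnSum (λ d → count (present d) (top t)) ≡ 9 + ⟦ t ⟧
    top-size false = refl
    top-size true = refl

  embed : Code → AxisPoint
  embed hub = onY false 1
  embed (at spine p) = onY true p
  embed (at east p) = onX true p
  embed (at west p) = onX false p

  unembed : AxisPoint → Code
  unembed (onY false _) = hub
  unembed (onY true p) = at spine p
  unembed (onX true p) = at east p
  unembed (onX false p) = at west p

  embed-injective : ∀ {a b} → embed a ≡ embed b → a ≡ b
  embed-injective {a} {b} eq = trans (unembed-embed a) (trans (cong unembed eq) (sym (unembed-embed b)))
    where
    unembed-embed : ∀ a → a ≡ unembed (embed a)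
    unembed-embed hub = refl
    unembed-embed (at spine p) = refl
    unembed-embed (at east p) = refl
    unembed-embed (at west p) = refl

  embed-away : ∀ {a} → Vertex a → AwayFromOrigin (embed a)
  embed-away hub = s≤s z≤n
  embed-away (at spine p pres) = present⇒positive spine p pres
  embed-away (at east p pres) = present⇒positive east p pres
  embed-away (at west p pres) = present⇒positive west p pres

  spoke-drawn : ∀ d x → 1 ≤ x → T (toHub d (kind x)) → Drawn (embed hub) (embed (at d x))
  spoke-drawn east x 1≤x _ = inj₂ (diagonal true 1≤x (s≤s z≤n) (hubward x))
  spoke-drawn west x 1≤x _ = inj₂ (diagonal false 1≤x (s≤s z≤n) (hubward x))

  across-drawn : ∀ c d p → 1 ≤ p → T (across c d (kind p)) → Drawn (embed (at c p)) (embed (at d p))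
  across-drawn spine east p 1≤p _ = inj₂ (diagonal true 1≤p 1≤p (level p))
  across-drawn spine west p 1≤p _ = inj₂ (diagonal false 1≤p 1≤p (level p))

  step-drawn : ∀ c d p → 1 ≤ p → T (step c d (kind p) (kind (suc p))) → Drawn (embed (at c p)) (embed (at d (suc p)))
  step-drawn spine spine p 1≤p _ = inj₁ (alongY 1≤p)
  step-drawn east east p 1≤p _ = inj₁ (alongX true 1≤p)
  step-drawn west west p 1≤p _ = inj₁ (alongX false 1≤p)
  step-drawn spine east p 1≤p _ = inj₂ (diagonal true (s≤s z≤n) 1≤p (slanted p))
  step-drawn spine west p 1≤p _ = inj₂ (diagonal false (s≤s z≤n) 1≤p (slanted p))

  drawn : ∀ {a b} → Vertex a → Vertex b → T (adjC a b) → Drawn (embed a) (embed b)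
  drawn hub (at d x pd) h = spoke-drawn d x (present⇒positive d x pd) h
  drawn (at c p pc) hub h = Data.Sum.swap (spoke-drawn c p (present⇒positive c p pc) h)
  drawn (at c p pc) (at d x pd) h with near p x | near-view p x
  ... | same | is-same .p with to (T-∨ {across c d (kind p)} {across d c (kind p)}) h
  ...   | inj₁ cd = across-drawn c d p (present⇒positive c p pc) cd
  ...   | inj₂ dc = Data.Sum.swap (across-drawn d c p (present⇒positive c p pc) dc)
  drawn (at c p pc) (at d x pd) h | above | is-above .p = step-drawn c d p (present⇒positive c p pc) h
  drawn (at c p pc) (at d x pd) h | below | is-below .x = Data.Sum.swap (step-drawn d c x (present⇒positive d x pd) h)

  colourOf : Code → Fin 5
  colourOf hub = # 0
  colourOf (at c p) = colour c (kind p)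

  colouring : ∀ {a b} → Vertex a → Vertex b → T (adjC a b) → T (c5 (colourOf a) (colourOf b))
  colouring hub (at d x pd) h = spoke-colour (window x) d pd h
  colouring (at c p pc) hub h = c5-sym (# 0) (colour c (kind p)) (spoke-colour (window p) c pc h)
  colouring (at c p pc) (at d x pd) h with near p x | near-view p x
  ... | same | is-same .p with to (T-∨ {across c d (kind p)} {across d c (kind p)}) h
  ...   | inj₁ cd = across-colour (window p) c d pc pd cd
  ...   | inj₂ dc = c5-sym (colour d (kind p)) (colour c (kind p)) (across-colour (window p) d c pd pc dc)
  colouring (at c p pc) (at d x pd) h | above | is-above .p =
    step-colour (window p) c d pc pd h
  colouring (at c p pc) (at d x pd) h | below | is-below .x =
    c5-sym (colour d (kind x)) (colour c (kind (suc x))) (step-colour (window x) d c pd pc h)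

  lookup-vertex : ∀ v → Vertex (lookup vertices v)
  lookup-vertex v = vertex (∈-lookup v)

  adj-T : ∀ u v → Adj graph u v → T (adjC (lookup vertices u) (lookup vertices v))
  adj-T u v = from T-≡

  planar : Planar graph
  planar = axis-drawing-planar graph (embed ∘ lookup vertices)
             (λ eq → lookup-injective vertices vertices-unique (embed-injective eq))
             (λ v → embed-away (lookup-vertex v))
             (λ u v u~v → drawn (lookup-vertex u) (lookup-vertex v) (adj-T u v u~v))

  triangle-free : ¬ HasCycle graph 3
  triangle-free (c , _ , edges , closing) =
    c5-triangle-free (col (c zero)) (col (c (suc zero))) (col (c (suc (suc zero))))
      (homomorphic (c zero) (c (suc zero)) (edges zero))
      (homomorphic (c (suc zero)) (c (suc (suc zero))) (edges (suc zero)))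
      (homomorphic (c (suc (suc zero))) (c zero) closing)
    where
    col : Fin (length vertices) → Fin 5
    col v = colourOf (lookup vertices v)
    homomorphic : ∀ u v → Adj graph u v → T (c5 (col u) (col v))
    homomorphic u v u~v = colouring (lookup-vertex u) (lookup-vertex v) (adj-T u v u~v)

  square : List Code
  square = hub ∷ at east 3 ∷ at spine 3 ∷ at east 4 ∷ []

  square-unique : Unique square
  square-unique = ((λ ()) All.∷ (λ ()) All.∷ (λ ()) All.∷ All.[]) ∷ ((λ ()) All.∷ (λ ()) All.∷ All.[]) ∷
                  ((λ ()) All.∷ All.[]) ∷ All.[] ∷ []

  square-∈ : ∀ i → lookup square i ∈ vertices
  square-∈ zero = here refl
  square-∈ (suc zero) = ∈-vertices east 3 _
  square-∈ (suc (suc zero)) = ∈-vertices spine 3 _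
  square-∈ (suc (suc (suc zero))) = ∈-vertices east 4 _

  corner : Fin 4 → Fin (length vertices)
  corner i = index (square-∈ i)

  corner-code : ∀ i → lookup vertices (corner i) ≡ lookup square i
  corner-code i = sym (lookup-index (square-∈ i))

  square-edge : ∀ i j → T (adjC (lookup square i) (lookup square j)) → Adj graph (corner i) (corner j)
  square-edge i j e = to T-≡ (subst₂ (λ a b → T (adjC a b)) (sym (corner-code i)) (sym (corner-code j)) e)

  four-cycle : HasCycle graph 4
  four-cycle = corner , corner-injective , edges , square-edge (# 3) zero _
    where
    corner-injective : Injective _≡_ _≡_ corner
    corner-injective {i} {j} eq =
      lookup-injective square square-unique (trans (sym (corner-code i)) (trans (cong (lookup vertices) eq) (corner-code j)))
    edges : ∀ (i : Fin 3) → Adj graph (corner (inject₁ i)) (corner (suc i))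
    edges zero = square-edge zero (# 1) _
    edges (suc zero) = square-edge (# 1) (# 2) _
    edges (suc (suc zero)) = square-edge (# 2) (# 3) _

  vertex-degree : ∀ {a} → Vertex a → count (adjC a) vertices ≡ 3 ⊎ count (adjC a) vertices ≡ hubDegree
  vertex-degree hub = inj₂ degree-hub
  vertex-degree (at c zero pres) = ⊥-elim (ℕ.1+n≰n (present⇒positive c zero pres))
  vertex-degree (at c (suc q) pres) = inj₁ (degree-three c q pres)

  degree-corner : ∀ i → degree graph (corner i) ≡ count (adjC (lookup square i)) vertices
  degree-corner i = trans (degree-graph (corner i)) (cong (λ a → count (adjC a) vertices) (corner-code i))

  isRMGraph : IsRMGraph 3 hubDegree 4 graph
  isRMGraph =
    (λ v → Data.Sum.map (trans (degree-graph v)) (trans (degree-graph v)) (vertex-degree (lookup-vertex v))) ,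
    (corner (# 1) , trans (degree-corner (# 1)) (degree-three east 2 _)) ,
    (corner zero , trans (degree-corner zero) degree-hub) ,
    (s≤s (s≤s (s≤s z≤n)) , four-cycle , no-shorter)
    where
    no-shorter : ∀ l → 3 ≤ l → l < 4 → ¬ HasCycle graph l
    no-shorter 0 () _
    no-shorter 1 (s≤s ()) _
    no-shorter 2 (s≤s (s≤s ())) _
    no-shorter 3 _ _ = triangle-free
    no-shorter (suc (suc (suc (suc l)))) _ (s≤s (s≤s (s≤s (s≤s ()))))

open import Data.Bool using (Bool; true; false)
open import Data.List using (length)
open import Data.Nat as ℕ using (ℕ; zero; suc; _+_; _*_; _≤_; _<_; _/_)
import Data.Nat.Properties as ℕ
open import Data.Nat.DivMod using (m/n≡1+[m∸n]/n; /-monoˡ-≤)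
import Data.Nat.Solver
open import Data.Product using (Σ; _×_; _,_)
open import Relation.Binary.PropositionalEquality

open import Defs using (Graph; Planar; IsRMGraph; ceilDiv)
open Lists using (⟦_⟧)

open Data.Nat.Solver.+-*-Solver using (solve; _:+_; _:*_; _:=_; con)

[x+5]/5≡1+x/5 : ∀ x → (x + 5) / 5 ≡ 1 + x / 5
[x+5]/5≡1+x/5 x = trans (m/n≡1+[m∸n]/n (ℕ.m≤n+m 5 x)) (cong (λ y → 1 + y / 5) (ℕ.m+n∸n≡m x 5))

12+2k≤4*[18+3k+x]/5 : ∀ k x → 12 + 2 * k ≤ 4 * ((18 + 3 * k + x) / 5)
12+2k≤4*[18+3k+x]/5 zero x = ℕ.*-monoʳ-≤ 4 (/-monoˡ-≤ 5 (ℕ.m≤m+n 15 (3 + x)))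
12+2k≤4*[18+3k+x]/5 (suc zero) x = ℕ.≤-trans (ℕ.m≤n+m 14 2) (ℕ.*-monoʳ-≤ 4 (/-monoˡ-≤ 5 (ℕ.m≤m+n 20 (1 + x))))
12+2k≤4*[18+3k+x]/5 (suc (suc k)) x = begin
  12 + 2 * (2 + k)                      ≡⟨ regroup ⟩
  4 + (12 + 2 * k)                      ≤⟨ ℕ.+-monoʳ-≤ 4 (12+2k≤4*[18+3k+x]/5 k (1 + x)) ⟩
  4 + 4 * (y / 5)                       ≡⟨ sym (ℕ.*-distribˡ-+ 4 1 (y / 5)) ⟩
  4 * (1 + y / 5)                       ≡⟨ cong (4 *_) (sym ([x+5]/5≡1+x/5 y)) ⟩
  4 * ((y + 5) / 5)                     ≡⟨ cong (λ z → 4 * (z / 5)) shift ⟩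
  4 * ((18 + 3 * (2 + k) + x) / 5)      ∎
  where
  open ℕ.≤-Reasoning
  y : ℕ
  y = 18 + 3 * k + (1 + x)
  regroup : 12 + 2 * (2 + k) ≡ 4 + (12 + 2 * k)
  regroup = solve 1 (λ k → con 12 :+ con 2 :* (con 2 :+ k) := con 4 :+ (con 12 :+ con 2 :* k)) refl k
  shift : y + 5 ≡ 18 + 3 * (2 + k) + x
  shift = solve 2 (λ k x → con 18 :+ con 3 :* k :+ (con 1 :+ x) :+ con 5 := con 18 :+ con 3 :* (con 2 :+ k) :+ x)
                refl k x

order-bound : ∀ k a b → let m = 13 + (3 * k + a + b) in
              28 + (5 * k + a + b) ≤ m + 4 * ceilDiv (m + 1) 5 + 3
order-bound k a b = begin
  28 + (5 * k + a + b)                         ≡⟨ split ⟩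
  m + (12 + 2 * k) + 3                         ≤⟨ ℕ.+-monoˡ-≤ 3 (ℕ.+-monoʳ-≤ m (12+2k≤4*[18+3k+x]/5 k (a + b))) ⟩
  m + 4 * ((18 + 3 * k + (a + b)) / 5) + 3     ≡⟨ cong (λ z → m + 4 * (z / 5) + 3) ceiling ⟩
  m + 4 * ceilDiv (m + 1) 5 + 3                ∎
  where
  open ℕ.≤-Reasoning
  m : ℕ
  m = 13 + (3 * k + a + b)
  split : 28 + (5 * k + a + b) ≡ m + (12 + 2 * k) + 3
  split = solve 3 (λ k a b → con 28 :+ (con 5 :* k :+ a :+ b) :=
                             con 13 :+ (con 3 :* k :+ a :+ b) :+ (con 12 :+ con 2 :* k) :+ con 3) refl k a b
  ceiling : 18 + 3 * k + (a + b) ≡ m + 1 + 4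
  ceiling = solve 3 (λ k a b → con 18 :+ con 3 :* k :+ (a :+ b) := con 13 :+ (con 3 :* k :+ a :+ b) :+ con 1 :+ con 4)
                  refl k a b

residue-split : ∀ r → Σ ℕ λ k → Σ Bool λ e → Σ Bool λ t → 3 * k + ⟦ e ⟧ + ⟦ t ⟧ ≡ r
residue-split 0 = 0 , false , false , refl
residue-split 1 = 0 , true , false , refl
residue-split 2 = 0 , true , true , refl
residue-split (suc (suc (suc r))) with residue-split r
... | k , e , t , refl =
  suc k , e , t , solve 3 (λ k a b → con 3 :* (con 1 :+ k) :+ a :+ b := con 3 :+ (con 3 :* k :+ a :+ b)) refl k ⟦ e ⟧ ⟦ t ⟧

Realised : ℕ → Set
Realised m = Σ ℕ λ n → Σ (Graph n) λ G → Planar G × IsRMGraph 3 m 4 G × n ≤ m + 4 * ceilDiv (m + 1) 5 + 3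

strip-realises : ∀ k e t → Realised (13 + (3 * k + ⟦ e ⟧ + ⟦ t ⟧))
strip-realises k e t =
  length vertices , graph , planar , isRMGraph ,
  subst (_≤ hubDegree + 4 * ceilDiv (hubDegree + 1) 5 + 3) (sym length-vertices) (order-bound k ⟦ e ⟧ ⟦ t ⟧)
  where open StripGraph k e t

-- The construction works for every m ≥ 13.
mainTheorem11 : ∀ (m : ℕ) → 14 < m →
    Σ ℕ λ n → Σ (Graph n) λ G →
    Planar G × IsRMGraph 3 m 4 G × n ≤ m + 4 * ceilDiv (m + 1) 5 + 3
mainTheorem11 m 14<m =
  let r , 13+r≡m = ℕ.m≤n⇒∃[o]m+o≡n (ℕ.≤-trans (ℕ.n≤1+n 13) (ℕ.<⇒≤ 14<m))
      k , e , t , split≡r = residue-split r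
  in subst Realised (trans (cong (13 +_) split≡r) 13+r≡m) (strip-realises k e t)
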